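{- Let $n\ge1$ and let $\mu=(\mu_1,\dots,\mu_n)\subseteq\delta_{n-1}$ be a partition, padded with zeros to length $n$. Then $$r^{(n)}_\mu=\det\left(\binom{n-i}{\mu_j-j+i}\right)_{1\le i,j\le n}=2^{|\mu|-\binom{n}{2}}\det\left(\binom{2n-2i}{\mu_j+n-j}\right)_{1\le i,j\le n}.$$
   Context: $\delta_{n-1}=(n-1,n-2,\dots,1)$ is the staircase partition, and $\mu\subseteq\delta_{n-1}$ means containment of Ferrers diagrams; $|\mu|=\sum_i\mu_i$. A reverse flagged filling of shape $\mu$ is a filling of the boxes of $\mu$ with positive integers such that entries strictly decrease from left to right along each row, weakly decrease down each column, and every entry in row $i$ lies in $\{1,\dots,n-i\}$; $r^{(n)}_\mu$ is the number of such fillings. Binomial coefficients $\binom{a}{b}$ are taken to be $0$ when $b<0$ or $b>a$. -}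

module Defs where

open import Data.Nat using (ℕ; zero; suc; _+_; _*_; _∸_; _^_; _≤_; _<_)
open import Data.Nat.Combinatorics using (_C_)
open import Data.Fin using (Fin; toℕ; punchIn) renaming (zero to fzero; suc to fsuc)
open import Data.Vec using (Vec; lookup)
open import Data.Integer as ℤ using (ℤ; +_; -[1+_])
open import Relation.Binary.PropositionalEquality using (_≡_)

-- Binomial coefficient with integer lower index; 0 when b < 0 or b > a.
binomℤ : ℕ → ℤ → ℤ
binomℤ a (+ b)    = + (a C b)
binomℤ a -[1+ _ ] = + 0

sumFin : (n : ℕ) → (Fin n → ℤ) → ℤ
sumFin zero    f = + 0
sumFin (suc n) f = f fzero ℤ.+ sumFin n (λ j → f (fsuc j))

sumFinℕ : (n : ℕ) → (Fin n → ℕ) → ℕ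
sumFinℕ zero    f = 0
sumFinℕ (suc n) f = f fzero + sumFinℕ n (λ j → f (fsuc j))

sign : ℕ → ℤ
sign zero          = + 1
sign (suc zero)    = ℤ.- (+ 1)
sign (suc (suc k)) = sign k

det : (n : ℕ) → (Fin n → Fin n → ℤ) → ℤ
det zero    A = + 1
det (suc n) A =
  sumFin (suc n) (λ j → sign (toℕ j) ℤ.* (A fzero j ℤ.* det n (λ i k → A (fsuc i) (punchIn j k))))

-- μ (padded to length n, 0-indexed) is a partition contained in δ_{n-1}:
-- weakly decreasing and μ_i ≤ n - i in 1-indexed terms, i.e. μ (i) ≤ n ∸ suc i here.
record InStaircase (n : ℕ) (μ : Fin n → ℕ) : Set where
  field
    decreasing : ∀ (i i′ : Fin n) → toℕ i < toℕ i′ → μ i′ ≤ μ i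
    bounded    : ∀ (i : Fin n) → μ i ≤ n ∸ suc (toℕ i)

size : (n : ℕ) → (Fin n → ℕ) → ℕ
size n μ = sumFinℕ n μ

entry : {n : ℕ} → Vec (Vec ℕ n) n → Fin n → Fin n → ℕ
entry T i j = lookup (lookup T i) j

-- A reverse flagged filling of shape μ, encoded as an n×n matrix of naturals
-- with entry (i,j) (0-indexed) being the entry of box (i+1,j+1) if j < μ i,
-- and 0 outside the diagram (so the encoding is canonical).
record IsReverseFlagged (n : ℕ) (μ : Fin n → ℕ) (T : Vec (Vec ℕ n) n) : Set where
  field
    outside   : ∀ (i j : Fin n) → μ i ≤ toℕ j → entry T i j ≡ 0
    positive  : ∀ (i j : Fin n) → toℕ j < μ i → 1 ≤ entry T i j
    flagged   : ∀ (i j : Fin n) → toℕ j < μ i → entry T i j ≤ n ∸ suc (toℕ i)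
    rowStrict : ∀ (i j k : Fin n) → toℕ j < toℕ k → toℕ k < μ i → entry T i k < entry T i j
    colWeak   : ∀ (i i′ j : Fin n) → toℕ i < toℕ i′ → toℕ j < μ i′ → entry T i′ j ≤ entry T i j

-- The type of reverse flagged fillings (validity proof irrelevant, so two
-- fillings are equal iff their matrices are).
record Filling (n : ℕ) (μ : Fin n → ℕ) : Set where
  constructor filling
  field
    matrix : Vec (Vec ℕ n) n
    .valid : IsReverseFlagged n μ matrix

detA : (n : ℕ) → (Fin n → ℕ) → ℤ
detA n μ = det n (λ i j → binomℤ (n ∸ suc (toℕ i)) ((+ (μ j) ℤ.+ + (toℕ i)) ℤ.- + (toℕ j)))

detB : (n : ℕ) → (Fin n → ℕ) → ℤ
detB n μ = det n (λ i j → + ((2 * n ∸ 2 * suc (toℕ i)) C (μ j + n ∸ suc (toℕ j))))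

module Submission where

-- Rows of a reverse flagged filling strictly decrease, so an entry 1
-- can only be the last entry of a row.  Deleting the 1s and lowering all
-- remaining entries by one gives a reverse flagged filling for n-1 of the
-- shape ν = μ - c, where c records the rows that ended in a 1 (the last row
-- of μ must be empty).  Hence the number r(n, μ) satisfies
--     r(n+1, μ) = Σ_c [c valid] · r(n, μ - c),    r(n+1, μ) = 0 if μ_n ≠ 0.
-- Both determinants satisfy the same recursion: Pascal's rule splits every
-- column into two, the determinant is multilinear in the columns, and the
-- invalid choices c produce two equal columns or a zero column.  For the
-- second determinant a row operation is needed first and the rule becomes
-- binom(h+2, y) - binom(h, y) = 2·binom(h, y-1) + binom(h, y-2), which
-- contributes the power of two.

open import Defs
open import Data.Nat as ℕ using (ℕ; zero; suc; z≤n; s≤s; _≤_; _∸_; _^_)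
import Data.Nat.Properties as ℕP
import Data.Nat.Tactic.RingSolver as ℕSolver
open import Data.Nat.Combinatorics using (_C_; nCk+nC[k+1]≡[n+1]C[k+1]; nC1≡n)
open import Data.Integer as ℤ using (ℤ; +_; -[1+_]; _+_; _*_; -_; _-_)
open import Data.Integer.Properties
  using (+-identityˡ; +-identityʳ; +-comm; *-identityˡ; *-zeroʳ; *-assoc; *-distribˡ-+;
         pos-+; pos-*; m-n≡m⊖n; ⊖-≥)
open import Data.Integer.Tactic.RingSolver using (solve-∀)
open import Data.Fin using (Fin; toℕ; punchIn; punchOut; inject₁; fromℕ; fromℕ<)
  renaming (zero to fzero; suc to fsuc)
open import Data.Fin.Properties
  using (toℕ-injective; punchIn-injective; punchIn-punchOut; punchInᵢ≢i; toℕ-inject₁; toℕ-fromℕ;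
         toℕ-fromℕ<; toℕ<n; suc-injective)
open import Data.Bool using (Bool; true; false; if_then_else_)
open import Data.Empty using (⊥-elim; ⊥-elim-irr)
open import Data.Sum using (_⊎_; inj₁; inj₂)
open import Data.Product using (Σ; _×_; _,_; proj₁; proj₂)
open import Data.List as List using (List; []; _∷_; _++_; map; length)
import Data.List.Properties as ListP
open import Data.List.Membership.Propositional using (_∈_)
open import Data.List.Membership.Propositional.Properties
  using (∈-map⁺; ∈-map⁻; ∈-++⁺ˡ; ∈-++⁺ʳ; ∈-++⁻; ∈-lookup)
open import Data.List.Relation.Unary.Any using (here; index)
open import Data.List.Relation.Unary.Any.Properties using (lookup-index; ¬Any[])
import Data.List.Relation.Unary.All as All
open import Data.List.Relation.Unary.AllPairs using ([]; _∷_)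
open import Data.List.Relation.Unary.Unique.Propositional using (Unique)
import Data.List.Relation.Unary.Unique.Propositional.Properties as Unique
open import Data.Vec using (Vec; []; _∷_; lookup; tabulate; replicate)
import Data.Vec.Properties as VecP
open import Function.Bundles using (_↔_; mk↔ₛ′)
open import Relation.Binary.Definitions using (tri<; tri≈; tri>)
open import Relation.Binary.PropositionalEquality
open import Relation.Nullary using (Dec; yes; no; ¬_)
open import Relation.Nullary.Decidable using (_⊎-dec_; _→-dec_; _×-dec_; ¬?; decidable-stable)

-- (1) Determinants by Laplace expansion along the first row (Defs.det).
module Determinant where

  sumFin-ext : ∀ n {f g : Fin n → ℤ} → (∀ j → f j ≡ g j) → sumFin n f ≡ sumFin n g
  sumFin-ext zero    h = refl
  sumFin-ext (suc n) h = cong₂ _+_ (h fzero) (sumFin-ext n (λ j → h (fsuc j)))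

  sumFin-+ : ∀ n (f g : Fin n → ℤ) → sumFin n (λ j → f j + g j) ≡ sumFin n f + sumFin n g
  sumFin-+ zero    f g = refl
  sumFin-+ (suc n) f g =
    trans (cong (_+_ (f fzero + g fzero)) (sumFin-+ n (λ j → f (fsuc j)) (λ j → g (fsuc j))))
          (interchange (f fzero) (g fzero) _ _)
    where
    interchange : ∀ a b c d → a + b + (c + d) ≡ a + c + (b + d)
    interchange = solve-∀

  sumFin-* : ∀ n a (f : Fin n → ℤ) → sumFin n (λ j → a * f j) ≡ a * sumFin n f
  sumFin-* zero    a f = sym (*-zeroʳ a)
  sumFin-* (suc n) a f = trans (cong (_+_ (a * f fzero)) (sumFin-* n a _)) (sym (*-distribˡ-+ a _ _))

  sumFin-*₂ : ∀ n x y (g : Fin n → ℤ) → x * (y * sumFin n g) ≡ sumFin n (λ i → x * (y * g i))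
  sumFin-*₂ n x y g = sym (trans (sumFin-* n x (λ i → y * g i)) (cong (x *_) (sumFin-* n y g)))

  sumFin-0 : ∀ n {f : Fin n → ℤ} → (∀ j → f j ≡ + 0) → sumFin n f ≡ + 0
  sumFin-0 zero    h = refl
  sumFin-0 (suc n) h = cong₂ _+_ (h fzero) (sumFin-0 n (λ j → h (fsuc j)))

  sumFin-swap : ∀ n m (f : Fin n → Fin m → ℤ) →
    sumFin n (λ i → sumFin m (f i)) ≡ sumFin m (λ j → sumFin n (λ i → f i j))
  sumFin-swap zero    m f = sym (sumFin-0 m (λ j → refl))
  sumFin-swap (suc n) m f =
    trans (cong (_+_ (sumFin m (f fzero))) (sumFin-swap n m (λ i → f (fsuc i))))
          (sym (sumFin-+ m (f fzero) (λ j → sumFin n (λ i → f (fsuc i) j))))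

  sumFin-punch : ∀ n (f : Fin (suc n) → ℤ) c →
    sumFin (suc n) f ≡ f c + sumFin n (λ k → f (punchIn c k))
  sumFin-punch n       f fzero    = refl
  sumFin-punch (suc n) f (fsuc c) =
    trans (cong (_+_ (f fzero)) (sumFin-punch n (λ k → f (fsuc k)) c))
          (exchange (f fzero) (f (fsuc c)) _)
    where
    exchange : ∀ a b c → a + (b + c) ≡ b + (a + c)
    exchange = solve-∀

  sign-suc : ∀ k → sign (suc k) ≡ - sign k
  sign-suc zero          = refl
  sign-suc (suc zero)    = refl
  sign-suc (suc (suc k)) = sign-suc k

  det-ext : ∀ n {A B : Fin n → Fin n → ℤ} → (∀ i j → A i j ≡ B i j) → det n A ≡ det n B
  det-ext zero    h = refl
  det-ext (suc n) h = sumFin-ext (suc n) (λ j →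
    cong₂ (λ x y → sign (toℕ j) * (x * y)) (h fzero j) (det-ext n (λ i k → h (fsuc i) (punchIn j k))))

  -- Laplace expansion along the first column; by induction, expanding the
  -- minors of both expansions once more yields the same double sum.
  det-colExpansion : ∀ n (A : Fin (suc n) → Fin (suc n) → ℤ) →
    det (suc n) A ≡ sumFin (suc n) (λ i → sign (toℕ i) * (A i fzero * det n (λ r c → A (punchIn i r) (fsuc c))))
  det-colExpansion zero    A = refl
  det-colExpansion (suc n) A = cong (_+_ (sign 0 * (A fzero fzero * det (suc n) (λ i k → A (fsuc i) (fsuc k))))) tails
    where
    D : Fin (suc n) → Fin (suc n) → ℤ
    D i j = det n (λ r c → A (fsuc (punchIn i r)) (fsuc (punchIn j c)))
    term : Fin (suc n) → Fin (suc n) → ℤ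
    term i j = sign (suc (toℕ j)) * (A fzero (fsuc j) * (sign (toℕ i) * (A (fsuc i) fzero * D i j)))
    term′ : Fin (suc n) → Fin (suc n) → ℤ
    term′ i j = sign (suc (toℕ i)) * (A (fsuc i) fzero * (sign (toℕ j) * (A fzero (fsuc j) * D i j)))
    rowSide : ∀ j → sign (toℕ (fsuc j)) * (A fzero (fsuc j) * det (suc n) (λ i k → A (fsuc i) (punchIn (fsuc j) k)))
                    ≡ sumFin (suc n) (λ i → term i j)
    rowSide j = trans (cong (λ z → sign (suc (toℕ j)) * (A fzero (fsuc j) * z))
                            (det-colExpansion n (λ i k → A (fsuc i) (punchIn (fsuc j) k))))
                      (sumFin-*₂ (suc n) (sign (suc (toℕ j))) (A fzero (fsuc j)) (λ i → sign (toℕ i) * (A (fsuc i) fzero * D i j)))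
    colSide : ∀ i → sign (toℕ (fsuc i)) * (A (fsuc i) fzero * det (suc n) (λ r c → A (punchIn (fsuc i) r) (fsuc c)))
                    ≡ sumFin (suc n) (term′ i)
    colSide i = sumFin-*₂ (suc n) (sign (suc (toℕ i))) (A (fsuc i) fzero) (λ j → sign (toℕ j) * (A fzero (fsuc j) * D i j))
    swapSigns : ∀ si sj a b d → - sj * (a * (si * (b * d))) ≡ - si * (b * (sj * (a * d)))
    swapSigns = solve-∀
    term≡term′ : ∀ i j → term i j ≡ term′ i j
    term≡term′ i j rewrite sign-suc (toℕ i) | sign-suc (toℕ j) =
      swapSigns (sign (toℕ i)) (sign (toℕ j)) (A fzero (fsuc j)) (A (fsuc i) fzero) (D i j)
    tails : sumFin (suc n) (λ j → sign (toℕ (fsuc j)) * (A fzero (fsuc j) * det (suc n) (λ i k → A (fsuc i) (punchIn (fsuc j) k))))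
          ≡ sumFin (suc n) (λ i → sign (toℕ (fsuc i)) * (A (fsuc i) fzero * det (suc n) (λ r c → A (punchIn (fsuc i) r) (fsuc c))))
    tails = begin
      _ ≡⟨ sumFin-ext (suc n) rowSide ⟩
      sumFin (suc n) (λ j → sumFin (suc n) (λ i → term i j)) ≡⟨ sumFin-swap (suc n) (suc n) (λ j i → term i j) ⟩
      sumFin (suc n) (λ i → sumFin (suc n) (term i))        ≡⟨ sumFin-ext (suc n) (λ i → sumFin-ext (suc n) (term≡term′ i)) ⟩
      sumFin (suc n) (λ i → sumFin (suc n) (term′ i))       ≡⟨ sym (sumFin-ext (suc n) colSide) ⟩
      _ ∎
      where open ≡-Reasoning

  -- det Aᵀ = det A: the first-row expansion of Aᵀ is the first-column
  -- expansion of A.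
  det-transpose : ∀ n (A : Fin n → Fin n → ℤ) → det n (λ i j → A j i) ≡ det n A
  det-transpose zero    A = refl
  det-transpose (suc n) A =
    trans (sumFin-ext (suc n) (λ j → cong (λ z → sign (toℕ j) * (A j fzero * z))
                                          (det-transpose n (λ r c → A (punchIn j r) (fsuc c)))))
          (sym (det-colExpansion n A))

  toℕ-punchIn-< : ∀ {n} (j : Fin (suc n)) (k : Fin n) → toℕ k ℕ.< toℕ j → toℕ (punchIn j k) ≡ toℕ k
  toℕ-punchIn-< (fsuc j) fzero    p       = refl
  toℕ-punchIn-< (fsuc j) (fsuc k) (s≤s p) = cong suc (toℕ-punchIn-< j k p)

  toℕ-punchIn-≥ : ∀ {n} (j : Fin (suc n)) (k : Fin n) → toℕ j ≤ toℕ k → toℕ (punchIn j k) ≡ suc (toℕ k)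
  toℕ-punchIn-≥ fzero    k        p       = refl
  toℕ-punchIn-≥ (fsuc j) (fsuc k) (s≤s p) = cong suc (toℕ-punchIn-≥ j k p)

  det-colLinear : ∀ n (A B B′ : Fin n → Fin n → ℤ) (c : Fin n) (x y : ℤ) →
    (∀ i j → j ≢ c → B i j ≡ A i j) → (∀ i j → j ≢ c → B′ i j ≡ A i j) →
    (∀ i → A i c ≡ x * B i c + y * B′ i c) → det n A ≡ x * det n B + y * det n B′
  det-colLinear (suc n) A B B′ c x y hB hB′ hc =
    trans (sumFin-ext (suc n) split)
      (trans (sumFin-+ (suc n) (λ j → x * termOf B j) (λ j → y * termOf B′ j))
             (cong₂ _+_ (sumFin-* (suc n) x (termOf B)) (sumFin-* (suc n) y (termOf B′))))
    where
    minorOf : (Fin (suc n) → Fin (suc n) → ℤ) → Fin (suc n) → ℤ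
    minorOf M j = det n (λ i k → M (fsuc i) (punchIn j k))
    termOf : (Fin (suc n) → Fin (suc n) → ℤ) → Fin (suc n) → ℤ
    termOf M j = sign (toℕ j) * (M fzero j * minorOf M j)
    inEntry : ∀ s b c d x y → s * ((x * b + y * c) * d) ≡ x * (s * (b * d)) + y * (s * (c * d))
    inEntry = solve-∀
    inMinor : ∀ s a d e x y → s * (a * (x * d + y * e)) ≡ x * (s * (a * d)) + y * (s * (a * e))
    inMinor = solve-∀
    split : ∀ j → termOf A j ≡ x * termOf B j + y * termOf B′ j
    split j with j Data.Fin.≟ c
    ... | yes refl =
      trans (cong (λ z → sign (toℕ j) * (z * minorOf A j)) (hc fzero))
        (trans (inEntry (sign (toℕ j)) (B fzero j) (B′ fzero j) (minorOf A j) x y)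
          (cong₂ (λ u v → x * (sign (toℕ j) * (B fzero j * u)) + y * (sign (toℕ j) * (B′ fzero j * v)))
                 (det-ext n (λ i k → sym (hB (fsuc i) (punchIn j k) (punchInᵢ≢i j k))))
                 (det-ext n (λ i k → sym (hB′ (fsuc i) (punchIn j k) (punchInᵢ≢i j k))))))
    ... | no j≢c =
      trans (cong (λ z → sign (toℕ j) * (A fzero j * z)) minorLinear)
        (trans (inMinor (sign (toℕ j)) (A fzero j) (minorOf B j) (minorOf B′ j) x y)
          (cong₂ (λ u v → x * (sign (toℕ j) * (u * minorOf B j)) + y * (sign (toℕ j) * (v * minorOf B′ j)))
                 (sym (hB fzero j j≢c)) (sym (hB′ fzero j j≢c))))
      where
      c′ : Fin n
      c′ = punchOut j≢c
      avoid : ∀ k → k ≢ c′ → punchIn j k ≢ c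
      avoid k k≢c′ e = k≢c′ (punchIn-injective j k c′ (trans e (sym (punchIn-punchOut j≢c))))
      minorLinear : minorOf A j ≡ x * minorOf B j + y * minorOf B′ j
      minorLinear = det-colLinear n _ _ _ c′ x y
        (λ i k k≢ → hB (fsuc i) (punchIn j k) (avoid k k≢)) (λ i k k≢ → hB′ (fsuc i) (punchIn j k) (avoid k k≢))
        (λ i → subst (λ z → A (fsuc i) z ≡ x * B (fsuc i) z + y * B′ (fsuc i) z) (sym (punchIn-punchOut j≢c)) (hc (fsuc i)))

  toℕ-punchOut : ∀ {n} {j c : Fin (suc n)} (p : j ≢ c) →
    (toℕ (punchOut p) ≡ toℕ c × toℕ c ℕ.< toℕ j) ⊎ (suc (toℕ (punchOut p)) ≡ toℕ c × toℕ j ℕ.< toℕ c)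
  toℕ-punchOut {n} {j} {c} p with toℕ (punchOut p) ℕ.<? toℕ j
  ... | yes lt = inj₁ (e , subst (ℕ._< toℕ j) e lt)
    where e = trans (sym (toℕ-punchIn-< j (punchOut p) lt)) (cong toℕ (punchIn-punchOut p))
  ... | no ge = inj₂ (e , subst (toℕ j ℕ.<_) e (s≤s (ℕP.≮⇒≥ ge)))
    where e = trans (sym (toℕ-punchIn-≥ j (punchOut p) (ℕP.≮⇒≥ ge))) (cong toℕ (punchIn-punchOut p))

  punchOut-adjacent : ∀ {n} {j c d : Fin (suc n)} (jc : j ≢ c) (jd : j ≢ d) →
    toℕ d ≡ suc (toℕ c) → toℕ (punchOut jd) ≡ suc (toℕ (punchOut jc))
  punchOut-adjacent {j = j} {c} jc jd dc with toℕ-punchOut jc | toℕ-punchOut jd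
  ... | inj₁ (e₁ , _)  | inj₁ (e₂ , _)  = trans e₂ (trans dc (cong suc (sym e₁)))
  ... | inj₁ (_ , l₁)  | inj₂ (_ , l₂)  = ⊥-elim (ℕP.<-irrefl refl (ℕP.<-≤-trans l₂ (subst (ℕ._≤ toℕ j) (sym dc) l₁)))
  ... | inj₂ (_ , l₁)  | inj₁ (_ , l₂)  = ⊥-elim (ℕP.<-asym l₁ (ℕP.<-trans (ℕP.n<1+n (toℕ c)) (subst (ℕ._< toℕ j) dc l₂)))
  ... | inj₂ (e₁ , _)  | inj₂ (e₂ , _)  = ℕP.suc-injective (trans e₂ (trans dc (cong suc (sym e₁))))

  punchIn-adjacent : ∀ {n} (c d : Fin (suc n)) → toℕ d ≡ suc (toℕ c) → ∀ k →
    punchIn c k ≡ punchIn d k ⊎ (punchIn c k ≡ d × punchIn d k ≡ c)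
  punchIn-adjacent c d dc k with ℕP.<-cmp (toℕ k) (toℕ c)
  ... | tri< lt _ _ = inj₁ (toℕ-injective (trans (toℕ-punchIn-< c k lt)
                             (sym (toℕ-punchIn-< d k (subst (toℕ k ℕ.<_) (sym dc) (ℕP.m<n⇒m<1+n lt))))))
  ... | tri≈ _ eq _ = inj₂ ( toℕ-injective (trans (toℕ-punchIn-≥ c k (ℕP.≤-reflexive (sym eq))) (trans (cong suc eq) (sym dc)))
                           , toℕ-injective (trans (toℕ-punchIn-< d k (subst (toℕ k ℕ.<_) (sym dc) (s≤s (ℕP.≤-reflexive eq)))) eq))
  ... | tri> _ _ gt = inj₁ (toℕ-injective (trans (toℕ-punchIn-≥ c k (ℕP.<⇒≤ gt))
                             (sym (toℕ-punchIn-≥ d k (subst (_≤ toℕ k) (sym dc) gt)))))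

  AdjacentColumnsVanish : ℕ → Set
  AdjacentColumnsVanish n = ∀ (A : Fin n → Fin n → ℤ) (c d : Fin n) → toℕ d ≡ suc (toℕ c) →
    (∀ i → A i c ≡ A i d) → det n A ≡ + 0

  -- Expanding along the first row, the terms for columns c and c+1 cancel and
  -- every other term has a minor with two equal adjacent columns.
  det-adjacentColumns-step : ∀ n → AdjacentColumnsVanish (suc n) → AdjacentColumnsVanish (suc (suc n))
  det-adjacentColumns-step n IH A c d dc same =
    begin
      det (suc (suc n)) A                                         ≡⟨ sumFin-punch (suc n) term c ⟩
      term c + sumFin (suc n) (λ k → term (punchIn c k))          ≡⟨ cong (_+_ (term c)) (sumFin-punch n (λ k → term (punchIn c k)) d′) ⟩
      term c + (term (punchIn c d′) + sumFin n (λ l → term (punchIn c (punchIn d′ l))))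
        ≡⟨ cong₂ (λ u v → term c + (term u + v)) (punchIn-punchOut c≢d) (sumFin-0 n (λ l → otherTerms (punchIn c (punchIn d′ l))
                  (punchInᵢ≢i c _) (λ e → punchInᵢ≢i d′ l (punchIn-injective c _ _ (trans e (sym (punchIn-punchOut c≢d))))))) ⟩
      term c + (term d + + 0)                                     ≡⟨ cong (_+_ (term c)) (+-identityʳ (term d)) ⟩
      term c + term d                                             ≡⟨ cancel ⟩
      + 0 ∎
    where
    open ≡-Reasoning
    term : Fin (suc (suc n)) → ℤ
    term j = sign (toℕ j) * (A fzero j * det (suc n) (λ i k → A (fsuc i) (punchIn j k)))
    c≢d : c ≢ d
    c≢d e = ℕP.1+n≢n (sym (trans (cong toℕ e) dc))
    d′ : Fin (suc n)
    d′ = punchOut c≢d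
    otherTerms : ∀ j → j ≢ c → j ≢ d → term j ≡ + 0
    otherTerms j jc jd =
      trans (cong (λ z → sign (toℕ j) * (A fzero j * z))
                  (IH (λ i k → A (fsuc i) (punchIn j k)) (punchOut jc) (punchOut jd) (punchOut-adjacent jc jd dc)
                      (λ i → trans (cong (A (fsuc i)) (punchIn-punchOut jc))
                               (trans (same (fsuc i)) (cong (A (fsuc i)) (sym (punchIn-punchOut jd)))))))
            (absorb (sign (toℕ j)) (A fzero j))
      where
      absorb : ∀ s a → s * (a * + 0) ≡ + 0
      absorb = solve-∀
    sameMinor : ∀ i k → A (fsuc i) (punchIn c k) ≡ A (fsuc i) (punchIn d k)
    sameMinor i k with punchIn-adjacent c d dc k
    ... | inj₁ e          = cong (A (fsuc i)) e
    ... | inj₂ (e₁ , e₂)  = trans (cong (A (fsuc i)) e₁) (trans (sym (same (fsuc i))) (cong (A (fsuc i)) (sym e₂)))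
    cancel : term c + term d ≡ + 0
    cancel =
      trans (cong₂ (λ u v → term c + sign u * (v * det (suc n) (λ i k → A (fsuc i) (punchIn d k)))) dc (sym (same fzero)))
        (trans (cong (λ z → term c + z * (A fzero c * det (suc n) (λ i k → A (fsuc i) (punchIn d k)))) (sign-suc (toℕ c)))
          (trans (cong (λ z → term c + (- sign (toℕ c)) * (A fzero c * z)) (sym (det-ext (suc n) sameMinor)))
                 (opposite (sign (toℕ c)) (A fzero c) _)))
      where
      opposite : ∀ s a x → s * (a * x) + (- s) * (a * x) ≡ + 0
      opposite = solve-∀

  det-adjacentColumns : ∀ n → AdjacentColumnsVanish n
  det-adjacentColumns (suc zero)    A fzero fzero () same
  det-adjacentColumns (suc (suc n)) = det-adjacentColumns-step n (det-adjacentColumns (suc n))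

  punchIn-last : ∀ n (k : Fin n) → punchIn (fromℕ n) k ≡ inject₁ k
  punchIn-last (suc n) fzero    = refl
  punchIn-last (suc n) (fsuc k) = cong fsuc (punchIn-last n k)

  punchIn-inject₁-last : ∀ n (k : Fin (suc n)) → punchIn (inject₁ k) (fromℕ n) ≡ fromℕ (suc n)
  punchIn-inject₁-last n       fzero    = refl
  punchIn-inject₁-last (suc n) (fsuc k) = cong fsuc (punchIn-inject₁-last n k)

  punchIn-inject₁ : ∀ {n} (k : Fin (suc n)) (l : Fin n) → punchIn (inject₁ k) (inject₁ l) ≡ inject₁ (punchIn k l)
  punchIn-inject₁ fzero    l        = refl
  punchIn-inject₁ (fsuc k) fzero    = refl
  punchIn-inject₁ (fsuc k) (fsuc l) = cong fsuc (punchIn-inject₁ k l)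

  det-lastColumnUnit : ∀ n (A : Fin (suc n) → Fin (suc n) → ℤ) → A (fromℕ n) (fromℕ n) ≡ + 1 →
    (∀ i → i ≢ fromℕ n → A i (fromℕ n) ≡ + 0) → det (suc n) A ≡ det n (λ i j → A (inject₁ i) (inject₁ j))
  det-lastColumnUnit zero    A one zeros = cong (λ z → sign 0 * (z * + 1) + + 0) one
  det-lastColumnUnit (suc n) A one zeros =
    trans (sumFin-punch (suc n) term (fromℕ (suc n)))
      (trans (cong₂ _+_ lastTerm (sumFin-ext (suc n) otherTerm))
             (+-identityˡ (det (suc n) (λ i j → A (inject₁ i) (inject₁ j)))))
    where
    term : Fin (suc (suc n)) → ℤ
    term j = sign (toℕ j) * (A fzero j * det (suc n) (λ i k → A (fsuc i) (punchIn j k)))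
    absorb : ∀ s x → s * (+ 0 * x) ≡ + 0
    absorb = solve-∀
    lastTerm : term (fromℕ (suc n)) ≡ + 0
    lastTerm = trans (cong (λ z → sign (toℕ (fromℕ (suc n))) * (z * lastMinor)) (zeros fzero (λ ())))
                     (absorb (sign (toℕ (fromℕ (suc n)))) lastMinor)
      where lastMinor = det (suc n) (λ i k → A (fsuc i) (punchIn (fromℕ (suc n)) k))
    otherTerm : ∀ k → term (punchIn (fromℕ (suc n)) k)
                    ≡ sign (toℕ k) * (A fzero (inject₁ k) * det n (λ i l → A (fsuc (inject₁ i)) (inject₁ (punchIn k l))))
    otherTerm k rewrite punchIn-last (suc n) k | toℕ-inject₁ k =
      cong (λ z → sign (toℕ k) * (A fzero (inject₁ k) * z))
        (trans (det-lastColumnUnit n (λ i l → A (fsuc i) (punchIn (inject₁ k) l))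
                  (trans (cong (A (fsuc (fromℕ n))) (punchIn-inject₁-last n k)) one)
                  (λ i i≢ → trans (cong (A (fsuc i)) (punchIn-inject₁-last n k)) (zeros (fsuc i) (λ e → i≢ (suc-injective e)))))
               (det-ext n (λ i l → cong (A (fsuc (inject₁ i))) (punchIn-inject₁ k l))))

-- (2) Matrices indexed by ℕ.  Entries outside the leading n × n block are
-- irrelevant for detN n, which lets us state row and column manipulations
-- without bounded index types.
module NatMatrix where
  open Determinant

  Mat : Set
  Mat = ℕ → ℕ → ℤ

  detN : ℕ → Mat → ℤ
  detN n M = det n (λ i j → M (toℕ i) (toℕ j))

  detN-ext : ∀ n {M M′ : Mat} → (∀ a b → a ℕ.< n → b ℕ.< n → M a b ≡ M′ a b) → detN n M ≡ detN n M′
  detN-ext n h = det-ext n (λ i j → h (toℕ i) (toℕ j) (toℕ<n i) (toℕ<n j))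

  detN-transpose : ∀ n (M : Mat) → detN n (λ a b → M b a) ≡ detN n M
  detN-transpose n M = det-transpose n (λ i j → M (toℕ i) (toℕ j))

  detN-colLinear : ∀ n (M B B′ : Mat) c → c ℕ.< n → (x y : ℤ) →
    (∀ a b → b ≢ c → B a b ≡ M a b) → (∀ a b → b ≢ c → B′ a b ≡ M a b) →
    (∀ a → a ℕ.< n → M a c ≡ x * B a c + y * B′ a c) → detN n M ≡ x * detN n B + y * detN n B′
  detN-colLinear n M B B′ c c<n x y hB hB′ hc =
    det-colLinear n _ _ _ (fromℕ< c<n) x y
      (λ i j j≢ → hB (toℕ i) (toℕ j) (λ e → j≢ (toℕ-injective (trans e (sym (toℕ-fromℕ< c<n))))))
      (λ i j j≢ → hB′ (toℕ i) (toℕ j) (λ e → j≢ (toℕ-injective (trans e (sym (toℕ-fromℕ< c<n))))))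
      (λ i → subst (λ z → M (toℕ i) z ≡ x * B (toℕ i) z + y * B′ (toℕ i) z) (sym (toℕ-fromℕ< c<n)) (hc (toℕ i) (toℕ<n i)))

  detN-rowLinear : ∀ n (M B B′ : Mat) c → c ℕ.< n → (x y : ℤ) →
    (∀ a b → a ≢ c → B a b ≡ M a b) → (∀ a b → a ≢ c → B′ a b ≡ M a b) →
    (∀ b → b ℕ.< n → M c b ≡ x * B c b + y * B′ c b) → detN n M ≡ x * detN n B + y * detN n B′
  detN-rowLinear n M B B′ c c<n x y hB hB′ hc =
    trans (sym (detN-transpose n M))
      (trans (detN-colLinear n (λ a b → M b a) (λ a b → B b a) (λ a b → B′ b a) c c<n x y
                (λ a b b≢ → hB b a b≢) (λ a b b≢ → hB′ b a b≢) hc)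
             (cong₂ (λ u v → x * u + y * v) (detN-transpose n B) (detN-transpose n B′)))

  detN-zeroColumn : ∀ n (M : Mat) c → c ℕ.< n → (∀ a → a ℕ.< n → M a c ≡ + 0) → detN n M ≡ + 0
  detN-zeroColumn n M c c<n h =
    trans (detN-colLinear n M M M c c<n (+ 0) (+ 0) (λ _ _ _ → refl) (λ _ _ _ → refl)
             (λ a a<n → trans (h a a<n) (sym (zeroCombination (M a c) (M a c)))))
          (zeroCombination (detN n M) (detN n M))
    where
    zeroCombination : ∀ (u v : ℤ) → + 0 * u + + 0 * v ≡ + 0
    zeroCombination = solve-∀

  detN-zeroRow : ∀ n (M : Mat) c → c ℕ.< n → (∀ b → b ℕ.< n → M c b ≡ + 0) → detN n M ≡ + 0
  detN-zeroRow n M c c<n h = trans (sym (detN-transpose n M)) (detN-zeroColumn n (λ a b → M b a) c c<n h)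

  detN-adjacentColumns : ∀ n (M : Mat) c → suc c ℕ.< n → (∀ a → a ℕ.< n → M a c ≡ M a (suc c)) → detN n M ≡ + 0
  detN-adjacentColumns n M c sc<n h =
    det-adjacentColumns n _ (fromℕ< c<n) (fromℕ< sc<n)
      (trans (toℕ-fromℕ< sc<n) (cong suc (sym (toℕ-fromℕ< c<n))))
      (λ i → trans (cong (M (toℕ i)) (toℕ-fromℕ< c<n))
               (trans (h (toℕ i) (toℕ<n i)) (cong (M (toℕ i)) (sym (toℕ-fromℕ< sc<n)))))
    where c<n = ℕP.<-trans (ℕP.n<1+n c) sc<n

  detN-adjacentRows : ∀ n (M : Mat) c → suc c ℕ.< n → (∀ b → b ℕ.< n → M c b ≡ M (suc c) b) → detN n M ≡ + 0
  detN-adjacentRows n M c sc<n h = trans (sym (detN-transpose n M)) (detN-adjacentColumns n (λ a b → M b a) c sc<n h)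

  detN-lastRowUnit : ∀ n (M : Mat) → M n n ≡ + 1 → (∀ b → b ℕ.< n → M n b ≡ + 0) → detN (suc n) M ≡ detN n M
  detN-lastRowUnit n M one zeros =
    trans (sym (detN-transpose (suc n) M))
      (trans (det-lastColumnUnit n (λ i j → M (toℕ j) (toℕ i))
                (subst (λ z → M z z ≡ + 1) (sym (toℕ-fromℕ n)) one)
                (λ i i≢ → subst (λ z → M z (toℕ i) ≡ + 0) (sym (toℕ-fromℕ n))
                   (zeros (toℕ i) (ℕP.≤∧≢⇒< (ℕP.≤-pred (toℕ<n i))
                                            (λ e → i≢ (toℕ-injective (trans e (sym (toℕ-fromℕ n)))))))))
        (trans (det-ext n (λ i j → cong₂ M (toℕ-inject₁ j) (toℕ-inject₁ i)))
               (detN-transpose n M)))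

  differenceRows : ℕ → Mat → Mat
  differenceRows k M a b with a ℕ.<? k
  ... | yes _ = M a b - M (suc a) b
  ... | no  _ = M a b

  differenceRows-< : ∀ k M a b → a ℕ.< k → differenceRows k M a b ≡ M a b - M (suc a) b
  differenceRows-< k M a b a<k with a ℕ.<? k
  ... | yes _   = refl
  ... | no  a≮k = ⊥-elim (a≮k a<k)

  differenceRows-≥ : ∀ k M a b → k ≤ a → differenceRows k M a b ≡ M a b
  differenceRows-≥ k M a b k≤a with a ℕ.<? k
  ... | yes a<k = ⊥-elim (ℕP.<-irrefl refl (ℕP.<-≤-trans a<k k≤a))
  ... | no  _   = refl

  differenceRows-offRow : ∀ k M a b → a ≢ k → differenceRows k M a b ≡ differenceRows (suc k) M a b
  differenceRows-offRow k M a b a≢k with ℕP.<-cmp a k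
  ... | tri< a<k _ _ = trans (differenceRows-< k M a b a<k) (sym (differenceRows-< (suc k) M a b (ℕP.m<n⇒m<1+n a<k)))
  ... | tri≈ _ a≡k _ = ⊥-elim (a≢k a≡k)
  ... | tri> _ _ k<a = trans (differenceRows-≥ k M a b (ℕP.<⇒≤ k<a)) (sym (differenceRows-≥ (suc k) M a b k<a))

  replaceRow : ℕ → (ℕ → ℤ) → Mat → Mat
  replaceRow k r M a b with a ℕ.≟ k
  ... | yes _ = r b
  ... | no  _ = M a b

  replaceRow-≢ : ∀ k r M a b → a ≢ k → replaceRow k r M a b ≡ M a b
  replaceRow-≢ k r M a b a≢k with a ℕ.≟ k
  ... | yes a≡k = ⊥-elim (a≢k a≡k)
  ... | no  _   = refl

  replaceRow-≡ : ∀ k r M b → replaceRow k r M k b ≡ r b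
  replaceRow-≡ k r M b with k ℕ.≟ k
  ... | yes _   = refl
  ... | no  k≢k = ⊥-elim (k≢k refl)

  -- Subtracting row a+1 from row a, successively for a = k-1, …, 0, does not
  -- change the determinant: each step is linear in row k, and the error term
  -- has row k equal to row k+1.
  detN-differenceRows : ∀ n (M : Mat) k → k ℕ.< n → detN n (differenceRows k M) ≡ detN n M
  detN-differenceRows n M zero    _     = detN-ext n (λ a b _ _ → differenceRows-≥ 0 M a b z≤n)
  detN-differenceRows n M (suc k) sk<n = begin
    detN n (differenceRows (suc k) M)
      ≡⟨ detN-rowLinear n (differenceRows (suc k) M) (differenceRows k M) repeated k k<n (+ 1) (- + 1)
           (differenceRows-offRow k M) (λ a b a≢k → trans (replaceRow-≢ k _ _ a b a≢k) (differenceRows-offRow k M a b a≢k)) onRow ⟩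
    + 1 * detN n (differenceRows k M) + - + 1 * detN n repeated
      ≡⟨ cong (λ z → + 1 * detN n (differenceRows k M) + - + 1 * z) repeatedVanishes ⟩
    + 1 * detN n (differenceRows k M) + - + 1 * + 0
      ≡⟨ dropZero (detN n (differenceRows k M)) ⟩
    detN n (differenceRows k M)
      ≡⟨ detN-differenceRows n M k k<n ⟩
    detN n M ∎
    where
    open ≡-Reasoning
    k<n : k ℕ.< n
    k<n = ℕP.<-trans (ℕP.n<1+n k) sk<n
    repeated : Mat
    repeated = replaceRow k (M (suc k)) (differenceRows k M)
    dropZero : ∀ x → + 1 * x + - + 1 * + 0 ≡ x
    dropZero = solve-∀
    asCombination : ∀ x y → x - y ≡ + 1 * x + - + 1 * y
    asCombination = solve-∀
    onRow : ∀ b → b ℕ.< n → differenceRows (suc k) M k b ≡ + 1 * differenceRows k M k b + - + 1 * repeated k b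
    onRow b _ = trans (differenceRows-< (suc k) M k b (ℕP.n<1+n k))
      (trans (asCombination (M k b) (M (suc k) b))
             (cong₂ (λ u v → + 1 * u + - + 1 * v) (sym (differenceRows-≥ k M k b ℕP.≤-refl)) (sym (replaceRow-≡ k _ _ b))))
    repeatedVanishes : detN n repeated ≡ + 0
    repeatedVanishes = detN-adjacentRows n repeated k sk<n (λ b _ →
      trans (replaceRow-≡ k _ _ b)
        (sym (trans (replaceRow-≢ k _ _ (suc k) b ℕP.1+n≢n) (differenceRows-≥ k M (suc k) b (ℕP.n≤1+n k)))))

-- Multilinear expansion over column choices: if every column of a matrix is
-- a sum U + V, a function that is linear in each column splits into 2^k terms,
-- one for each choice c of U (c b = false) or V (c b = true) in column b.
module Multilinear where
  open NatMatrix

  consColumn : (ℕ → ℤ) → Mat → Mat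
  consColumn x R a zero    = x a
  consColumn x R a (suc b) = R a b

  record ColumnMultilinear (k : ℕ) (D : Mat → ℤ) : Set where
    field
      ext    : ∀ M M′ → (∀ a b → b ℕ.< k → M a b ≡ M′ a b) → D M ≡ D M′
      linear : ∀ c → c ℕ.< k → ∀ M B B′ x y → (∀ a b → b ≢ c → B a b ≡ M a b) →
               (∀ a b → b ≢ c → B′ a b ≡ M a b) → (∀ a → M a c ≡ x * B a c + y * B′ a c) →
               D M ≡ x * D B + y * D B′
  open ColumnMultilinear

  detN-multilinear : ∀ n → ColumnMultilinear n (detN n)
  ext    (detN-multilinear n) M M′ h = detN-ext n (λ a b _ b<n → h a b b<n)
  linear (detN-multilinear n) c c<n M B B′ x y hB hB′ hc = detN-colLinear n M B B′ c c<n x y hB hB′ (λ a _ → hc a)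

  fixFirstColumn : ∀ {k D} → ColumnMultilinear (suc k) D → ∀ x → ColumnMultilinear k (λ R → D (consColumn x R))
  ext (fixFirstColumn ml x) M M′ h = ext ml _ _ h′
    where
    h′ : ∀ a b → b ℕ.< suc _ → consColumn x M a b ≡ consColumn x M′ a b
    h′ a zero    _       = refl
    h′ a (suc b) (s≤s p) = h a b p
  linear (fixFirstColumn ml x₀) c c<k M B B′ x y hB hB′ hc =
    linear ml (suc c) (s≤s c<k) (consColumn x₀ M) (consColumn x₀ B) (consColumn x₀ B′) x y (shifted hB) (shifted hB′) hc
    where
    shifted : ∀ {N} → (∀ a b → b ≢ c → N a b ≡ M a b) → ∀ a b → b ≢ suc c → consColumn x₀ N a b ≡ consColumn x₀ M a b
    shifted h a zero    _  = refl
    shifted h a (suc b) ne = h a b (λ e → ne (cong suc e))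

  Choice : Set
  Choice = ℕ → Bool

  consChoice : Bool → Choice → Choice
  consChoice x c zero    = x
  consChoice x c (suc a) = c a

  sumChoices : ℕ → (Choice → ℤ) → ℤ
  sumChoices zero    F = F (λ _ → false)
  sumChoices (suc k) F = sumChoices k (λ c → F (consChoice false c)) + sumChoices k (λ c → F (consChoice true c))

  sumChoices-ext : ∀ k {F G : Choice → ℤ} → (∀ c → F c ≡ G c) → sumChoices k F ≡ sumChoices k G
  sumChoices-ext zero    h = h _
  sumChoices-ext (suc k) h = cong₂ _+_ (sumChoices-ext k (λ c → h _)) (sumChoices-ext k (λ c → h _))

  sumChoices-* : ∀ k x F → sumChoices k (λ c → x * F c) ≡ x * sumChoices k F
  sumChoices-* zero    x F = refl
  sumChoices-* (suc k) x F =
    trans (cong₂ _+_ (sumChoices-* k x _) (sumChoices-* k x _)) (sym (*-distribˡ-+ x _ _))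

  select : Bool → ℤ → ℤ → ℤ
  select false u v = u
  select true  u v = v

  multilinear-expand : ∀ k D → ColumnMultilinear k D → ∀ (U V : Mat) →
    D (λ a b → U a b + V a b) ≡ sumChoices k (λ c → D (λ a b → select (c b) (U a b) (V a b)))
  multilinear-expand zero    D ml U V = ext ml _ _ (λ a b ())
  multilinear-expand (suc k) D ml U V =
    trans (linear ml 0 (s≤s z≤n) _ (consColumn (λ a → U a 0) R) (consColumn (λ a → V a 0) R) (+ 1) (+ 1)
                  restAgrees restAgrees (λ a → unitCombination (U a 0) (V a 0)))
      (trans (cong₂ _+_ (*-identityˡ (D (consColumn (λ a → U a 0) R))) (*-identityˡ (D (consColumn (λ a → V a 0) R))))
        (cong₂ _+_ (trans (multilinear-expand k _ (fixFirstColumn ml (λ a → U a 0)) (λ a b → U a (suc b)) (λ a b → V a (suc b)))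
                          (sumChoices-ext k (λ c → ext ml _ _ (firstColumn false c))))
                   (trans (multilinear-expand k _ (fixFirstColumn ml (λ a → V a 0)) (λ a b → U a (suc b)) (λ a b → V a (suc b)))
                          (sumChoices-ext k (λ c → ext ml _ _ (firstColumn true c))))))
    where
    R : Mat
    R a b = U a (suc b) + V a (suc b)
    unitCombination : ∀ u v → u + v ≡ + 1 * u + + 1 * v
    unitCombination = solve-∀
    restAgrees : ∀ {x} a b → b ≢ 0 → consColumn x R a b ≡ U a b + V a b
    restAgrees a zero    ne = ⊥-elim (ne refl)
    restAgrees a (suc b) _  = refl
    firstColumn : ∀ x c a b → b ℕ.< suc k →
      consColumn (λ a → select x (U a 0) (V a 0)) (λ a b → select (c b) (U a (suc b)) (V a (suc b))) a b
        ≡ select (consChoice x c b) (U a b) (V a b)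
    firstColumn x c a zero    _ = refl
    firstColumn x c a (suc b) _ = refl

  countFalse : ℕ → Choice → ℕ
  countFalse zero    c = 0
  countFalse (suc k) c = (if c 0 then 0 else 1) ℕ.+ countFalse k (λ a → c (suc a))

  multilinear-scale : ∀ k D → ColumnMultilinear k D → ∀ (c : Choice) x (U V : Mat) →
    D (λ a b → select (c b) (x * U a b) (V a b)) ≡ x ℤ.^ countFalse k c * D (λ a b → select (c b) (U a b) (V a b))
  multilinear-scale zero    D ml c x U V = trans (ext ml _ _ (λ a b ())) (sym (*-identityˡ _))
  multilinear-scale (suc k) D ml c x U V with c 0 in c₀
  ... | true =
    trans (ext ml _ _ (firstColumn (λ a b → x * U a b)))
      (trans (multilinear-scale k _ (fixFirstColumn ml (λ a → V a 0)) (λ a → c (suc a)) x (λ a b → U a (suc b)) (λ a b → V a (suc b)))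
             (cong (x ℤ.^ countFalse k (λ a → c (suc a)) *_) (sym (ext ml _ _ (firstColumn U)))))
    where
    firstColumn : ∀ (W : Mat) a b → b ℕ.< suc k →
      select (c b) (W a b) (V a b) ≡ consColumn (λ a → V a 0) (λ a b → select (c (suc b)) (W a (suc b)) (V a (suc b))) a b
    firstColumn W a zero    _ rewrite c₀ = refl
    firstColumn W a (suc b) _ = refl
  ... | false =
    trans (ext ml _ _ (firstColumn (λ a b → x * U a b)))
      (trans (linear ml 0 (s≤s z≤n) _ B B x (+ 0) restAgrees restAgrees (λ a → sym (dropZero x (U a 0))))
        (trans (dropZero x (D B))
          (trans (cong (x *_) (multilinear-scale k _ (fixFirstColumn ml (λ a → U a 0)) (λ a → c (suc a)) x
                                                  (λ a b → U a (suc b)) (λ a b → V a (suc b))))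
            (trans (sym (*-assoc x _ _))
                   (cong (x ℤ.^ suc (countFalse k (λ a → c (suc a))) *_) (sym (ext ml _ _ (firstColumn U))))))))
    where
    firstColumn : ∀ (W : Mat) a b → b ℕ.< suc k →
      select (c b) (W a b) (V a b) ≡ consColumn (λ a → W a 0) (λ a b → select (c (suc b)) (W a (suc b)) (V a (suc b))) a b
    firstColumn W a zero    _ rewrite c₀ = refl
    firstColumn W a (suc b) _ = refl
    B : Mat
    B = consColumn (λ a → U a 0) (λ a b → select (c (suc b)) (x * U a (suc b)) (V a (suc b)))
    dropZero : ∀ x u → x * u + + 0 * u ≡ x * u
    dropZero = solve-∀
    restAgrees : ∀ a b → b ≢ 0 → B a b ≡ consColumn (λ a → x * U a 0) (λ a b → select (c (suc b)) (x * U a (suc b)) (V a (suc b))) a b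
    restAgrees a zero    ne = ⊥-elim (ne refl)
    restAgrees a (suc b) _  = refl

-- (3) Removing one box from each row in a chosen set.  A shape is a function
-- μ : ℕ → ℕ (row a has μ a boxes); a choice c marks the rows that lose their
-- last box, giving the shape ν μ c.
module Choices where
  open NatMatrix
  open Multilinear

  searchBelow : (m : ℕ) (P : ℕ → Set) → (∀ a → Dec (P a)) → (∀ a → a ℕ.< m → P a) ⊎ (Σ ℕ λ a → a ℕ.< m × ¬ P a)
  searchBelow m P P? with ℕP.anyUpTo? (λ a → ¬? (P? a)) m
  ... | yes (a , a<m , ¬Pa) = inj₂ (a , a<m , ¬Pa)
  ... | no  none            = inj₁ (λ a a<m → decidable-stable (P? a) (λ ¬Pa → none (a , a<m , ¬Pa)))

  allBelow? : (m : ℕ) (P : ℕ → Set) → (∀ a → Dec (P a)) → Dec (∀ a → a ℕ.< m → P a)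
  allBelow? m P P? with searchBelow m P P?
  ... | inj₁ all             = yes all
  ... | inj₂ (a , a<m , ¬Pa) = no (λ all → ¬Pa (all a a<m))

  bit : Bool → ℕ
  bit true  = 1
  bit false = 0

  bit≤1 : ∀ b → bit b ≤ 1
  bit≤1 true  = ℕP.≤-refl
  bit≤1 false = z≤n

  ν : (ℕ → ℕ) → Choice → ℕ → ℕ
  ν μ c a = μ a ∸ bit (c a)

  ν≤μ : ∀ μ c a → ν μ c a ≤ μ a
  ν≤μ μ c a = ℕP.m∸n≤m (μ a) (bit (c a))

  μ≤1+ν : ∀ μ c a → μ a ≤ suc (ν μ c a)
  μ≤1+ν μ c a = bound (μ a) (bit (c a)) (bit≤1 (c a))
    where
    bound : ∀ x y → y ≤ 1 → x ≤ suc (x ∸ y)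
    bound x       zero          _        = ℕP.n≤1+n x
    bound zero    (suc zero)    _        = z≤n
    bound (suc x) (suc zero)    _        = ℕP.≤-refl
    bound x       (suc (suc y)) (s≤s ())

  Decreasing : ℕ → (ℕ → ℕ) → Set
  Decreasing m μ = ∀ a → suc a ℕ.< m → μ (suc a) ≤ μ a

  decreasing-mono : ∀ n μ → Decreasing n μ → ∀ a b → a ≤ b → b ℕ.< n → μ b ≤ μ a
  decreasing-mono n μ dec a b a≤b b<n with ℕP.m≤n⇒m<n∨m≡n a≤b
  ... | inj₂ refl = ℕP.≤-refl
  ... | inj₁ a<b with b
  ...   | suc b′ = ℕP.≤-trans (dec b′ b<n) (decreasing-mono n μ dec a b′ (ℕP.≤-pred a<b) (ℕP.<-trans (ℕP.n<1+n b′) b<n))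

  Removable : ℕ → (ℕ → ℕ) → Choice → Set
  Removable m μ c = ∀ a → a ℕ.< m → (c a ≡ false) ⊎ (1 ≤ μ a)

  StaysDecreasing : ℕ → (ℕ → ℕ) → Choice → Set
  StaysDecreasing m μ c = ∀ a → a ℕ.< m → suc a ℕ.< m → ν μ c (suc a) ≤ ν μ c a

  ValidChoice : ℕ → (ℕ → ℕ) → Choice → Set
  ValidChoice m μ c = Removable m μ c × StaysDecreasing m μ c

  validChoice? : ∀ m μ c → Dec (ValidChoice m μ c)
  validChoice? m μ c =
        allBelow? m _ (λ a → (c a Data.Bool.≟ false) ⊎-dec (1 ℕ.≤? μ a))
    ×-dec allBelow? m _ (λ a → (suc a ℕ.<? m) →-dec (ν μ c (suc a) ℕ.≤? ν μ c a))

  validChoice-decreasing : ∀ m μ c → ValidChoice m μ c → Decreasing m (ν μ c)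
  validChoice-decreasing m μ c (_ , stays) a sa<m = stays a (ℕP.<-trans (ℕP.n<1+n a) sa<m) sa<m

  onlyIf : ∀ {P : Set} → Dec P → ℤ → ℤ
  onlyIf (yes _) x = x
  onlyIf (no  _) x = + 0

  -- The parameter of column b after choosing c: the binomial determinants
  -- have columns K (μ b + base b) and, after Pascal's rule, K (μ b + base b - 1).
  colParam : (ℕ → ℤ) → (ℕ → ℕ) → Choice → ℕ → ℤ
  colParam base μ c b = + μ b + base b - + bit (c b)

  colParam-valid : ∀ m μ c (base : ℕ → ℤ) → Removable m μ c → ∀ b → b ℕ.< m →
    colParam base μ c b ≡ + ν μ c b + base b
  colParam-valid m μ c base removable b b<m with c b | removable b b<m
  ... | false | _       = +-identityʳ (+ μ b + base b)
  ... | true  | inj₁ ()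
  ... | true  | inj₂ p with μ b
  ...   | suc k = lowered (+ k) (base b)
    where
    lowered : ∀ k x → (+ 1 + k) + x - + 1 ≡ k + x
    lowered = solve-∀

  select-colParam : ∀ (K : ℤ → ℕ → ℤ) base μ c a b →
    select (c b) (K (+ μ b + base b) a) (K (+ μ b + base b - + 1) a) ≡ K (colParam base μ c b) a
  select-colParam K base μ c a b with c b
  ... | false = cong (λ z → K z a) (sym (+-identityʳ (+ μ b + base b)))
  ... | true  = refl

  -- The vanishing of choice determinants at invalid choices, for a column
  -- kernel K (column b of the matrix is a ↦ K (param b) a) whose base
  -- parameter drops by one from each column to the next.
  module InvalidChoices (K : ℤ → ℕ → ℤ) (base : ℕ → ℤ) (base-step : ∀ b → base (suc b) ≡ base b - + 1) where

    ChoiceMatrix : ℕ → (ℕ → ℕ) → Choice → Mat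
    ChoiceMatrix m μ c a b = K (colParam base μ c b) a

    LastColumnBoundary : ℕ → Set
    LastColumnBoundary m = ∀ a → suc a ≡ m → ∀ r → r ℕ.< m → K (base a - + 1) r ≡ + 0

    equalParams⇒vanish : ∀ m μ c b → suc b ℕ.< m → colParam base μ c b ≡ colParam base μ c (suc b) →
      detN m (ChoiceMatrix m μ c) ≡ + 0
    equalParams⇒vanish m μ c b sb<m e = detN-adjacentColumns m (ChoiceMatrix m μ c) b sb<m (λ a _ → cong (λ z → K z a) e)

    colParam-emptyMarked : ∀ μ c a → c a ≡ true → μ a ≡ 0 → colParam base μ c a ≡ + 0 + base a - + 1
    colParam-emptyMarked μ c a ca μa = cong₂ (λ u v → + u + base a - + bit v) μa ca

    colParam-emptyUnmarked : ∀ μ c a → c (suc a) ≡ false → μ (suc a) ≡ 0 →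
      colParam base μ c (suc a) ≡ + 0 + (base a - + 1) - + 0
    colParam-emptyUnmarked μ c a ca μa =
      trans (cong₂ (λ u v → + u + base (suc a) - + bit v) μa ca) (cong (λ z → + 0 + z - + 0) (base-step a))

    -- If an empty row a is marked, all rows below it are empty; following the
    -- marked rows downwards we meet an unmarked empty row (equal to column a's
    -- parameter) or fall off the last column (a zero column).
    emptyMarked⇒vanish : ∀ m μ c → Decreasing m μ → LastColumnBoundary m →
      ∀ d a → suc (a ℕ.+ d) ≡ m → c a ≡ true → μ a ≡ 0 → detN m (ChoiceMatrix m μ c) ≡ + 0
    emptyMarked⇒vanish m μ c dec boundary zero a e ca μa =
      detN-zeroColumn m (ChoiceMatrix m μ c) a a<m
        (λ r r<m → trans (cong (λ z → K z r) (trans (colParam-emptyMarked μ c a ca μa) (cong (_- + 1) (+-identityˡ (base a)))))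
                         (boundary a e′ r r<m))
      where
      e′ : suc a ≡ m
      e′ = trans (cong suc (sym (ℕP.+-identityʳ a))) e
      a<m : a ℕ.< m
      a<m = subst (a ℕ.<_) e′ (ℕP.n<1+n a)
    emptyMarked⇒vanish m μ c dec boundary (suc d) a e ca μa with c (suc a) in csa
    ... | true  = emptyMarked⇒vanish m μ c dec boundary d (suc a) (trans (cong suc (sym (ℕP.+-suc a d))) e) csa μsa≡0
      where
      sa<m : suc a ℕ.< m
      sa<m = subst (suc a ℕ.<_) e (s≤s (subst (suc a ≤_) (sym (ℕP.+-suc a d)) (s≤s (ℕP.m≤m+n a d))))
      μsa≡0 : μ (suc a) ≡ 0
      μsa≡0 = ℕP.n≤0⇒n≡0 (subst (μ (suc a) ≤_) μa (dec a sa<m))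
    ... | false = equalParams⇒vanish m μ c a sa<m
                    (trans (colParam-emptyMarked μ c a ca μa) (trans (regroup (base a)) (sym (colParam-emptyUnmarked μ c a csa μsa≡0))))
      where
      regroup : ∀ x → + 0 + x - + 1 ≡ + 0 + (x - + 1) - + 0
      regroup = solve-∀
      sa<m : suc a ℕ.< m
      sa<m = subst (suc a ℕ.<_) e (s≤s (subst (suc a ≤_) (sym (ℕP.+-suc a d)) (s≤s (ℕP.m≤m+n a d))))
      μsa≡0 : μ (suc a) ≡ 0
      μsa≡0 = ℕP.n≤0⇒n≡0 (subst (μ (suc a) ≤_) μa (dec a sa<m))

    -- If ν μ c fails to decrease at rows a, a+1, then row a is marked, row a+1
    -- is not, and μ a = μ (a+1); the two column parameters coincide.
    notDecreasing⇒equalParams : ∀ μ c a → μ (suc a) ≤ μ a → (c a ≡ false ⊎ 1 ≤ μ a) →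
      ¬ (ν μ c (suc a) ≤ ν μ c a) → colParam base μ c a ≡ colParam base μ c (suc a)
    notDecreasing⇒equalParams μ c a mono removable ¬dec with c a in ca | c (suc a) in csa
    ... | false | b₂    = ⊥-elim (¬dec (ℕP.≤-trans (ℕP.m∸n≤m (μ (suc a)) (bit b₂)) mono))
    ... | true  | true  = ⊥-elim (¬dec (ℕP.∸-monoˡ-≤ 1 mono))
    ... | true  | false =
      trans (cong (λ u → + u + base a - + 1) μa≡μsa)
        (trans (regroup (+ μ (suc a)) (base a)) (sym (cong (λ u → + μ (suc a) + u - + 0) (base-step a))))
      where
      regroup : ∀ u x → u + x - + 1 ≡ u + (x - + 1) - + 0
      regroup = solve-∀
      nonempty : (true ≡ false ⊎ 1 ≤ μ a) → 1 ≤ μ a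
      nonempty (inj₂ p) = p
      1≤μa : 1 ≤ μ a
      1≤μa = nonempty removable
      μa≡μsa : μ a ≡ μ (suc a)
      μa≡μsa = ℕP.≤-antisym (subst (_≤ μ (suc a)) (trans (ℕP.+-comm 1 (μ a ∸ 1)) (ℕP.m∸n+n≡m 1≤μa)) (ℕP.≰⇒> ¬dec)) mono

    invalidChoice⇒vanish : ∀ m μ c → Decreasing m μ → LastColumnBoundary m →
      ¬ ValidChoice m μ c → detN m (ChoiceMatrix m μ c) ≡ + 0
    invalidChoice⇒vanish m μ c dec boundary invalid with searchBelow m _ (λ a → (c a Data.Bool.≟ false) ⊎-dec (1 ℕ.≤? μ a))
    ... | inj₂ (a , a<m , notRemovable) =
      emptyMarked⇒vanish m μ c dec boundary (m ∸ suc a) a (ℕP.m+[n∸m]≡n a<m) ca μa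
      where
      ca : c a ≡ true
      ca with c a
      ... | true  = refl
      ... | false = ⊥-elim (notRemovable (inj₁ refl))
      μa : μ a ≡ 0
      μa with μ a
      ... | zero  = refl
      ... | suc k = ⊥-elim (notRemovable (inj₂ (s≤s z≤n)))
    ... | inj₁ removable with searchBelow m _ (λ a → (suc a ℕ.<? m) →-dec (ν μ c (suc a) ℕ.≤? ν μ c a))
    ...   | inj₁ stays = ⊥-elim (invalid (removable , stays))
    ...   | inj₂ (a , a<m , fails) =
      equalParams⇒vanish m μ c a sa<m (notDecreasing⇒equalParams μ c a (dec a sa<m) (removable a a<m) (λ le → fails (λ _ → le)))
      where
      sa<m : suc a ℕ.< m
      sa<m with suc a ℕ.<? m
      ... | yes p  = p
      ... | no ¬p  = ⊥-elim (fails (λ p → ⊥-elim (¬p p)))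

-- (4) The two determinants, for shapes μ : ℕ → ℕ on m rows, satisfy
--   det(m+1, μ) = 0                                     if μ m ≠ 0,
--   det(m+1, μ) = Σ_c [c valid] · w(c) · det(m, ν μ c)   if μ m = 0,
-- with weight w(c) = 1 for the first and 2^(#unmarked rows) for the second.
module Recurrences where
  open NatMatrix
  open Multilinear
  open Choices

  pos-∸ : ∀ m b → b ≤ m → + (m ∸ b) ≡ + m - + b
  pos-∸ m b b≤m = sym (trans (m-n≡m⊖n m b) (⊖-≥ b≤m))

  ∸-suc : ∀ m a → a ℕ.< m → m ∸ a ≡ suc (m ∸ suc a)
  ∸-suc m a a<m = ℕP.+-∸-assoc 1 a<m

  1≤-nonzero : ∀ {n} → n ≢ 0 → 1 ≤ n
  1≤-nonzero {zero}  n≢0 = ⊥-elim (n≢0 refl)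
  1≤-nonzero {suc n} _   = s≤s z≤n

  suc-pred : ∀ {n} → 1 ≤ n → n ≡ suc (n ∸ 1)
  suc-pred {suc n} _ = refl

  aboveNonempty : ∀ m μ → Decreasing (suc m) μ → μ m ≢ 0 → ∀ b → b ≤ m → 1 ≤ μ b
  aboveNonempty m μ dec μm≢0 b b≤m = ℕP.≤-trans (1≤-nonzero μm≢0) (decreasing-mono (suc m) μ dec b m b≤m (ℕP.n<1+n m))

  binomℤ-pascal : ∀ h y → binomℤ (suc h) y ≡ binomℤ h y + binomℤ h (y - + 1)
  binomℤ-pascal h (+ zero)  = refl
  binomℤ-pascal h (+ suc k) = trans (cong +_ (sym (nCk+nC[k+1]≡[n+1]C[k+1] h k)))
                                    (trans (pos-+ (h C k) (h C suc k)) (+-comm (+ (h C k)) (+ (h C suc k))))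
  binomℤ-pascal h -[1+ k ]  = refl

  binomℤ-pascal₂ : ∀ h y → binomℤ (suc (suc h)) y - binomℤ h y ≡ + 2 * binomℤ h (y - + 1) + binomℤ h (y - + 1 - + 1)
  binomℤ-pascal₂ h y rewrite binomℤ-pascal (suc h) y | binomℤ-pascal h y | binomℤ-pascal h (y - + 1) =
    collect (binomℤ h y) (binomℤ h (y - + 1)) (binomℤ h (y - + 1 - + 1))
    where
    collect : ∀ p q r → p + q + (q + r) - p ≡ + 2 * q + r
    collect = solve-∀

  -- First determinant: entry (a, b) is binom(m-1-a, μ b - b + a).
  kernelA : ℕ → ℤ → ℕ → ℤ
  kernelA m z a = binomℤ (m ∸ suc a) (z + + a)

  baseA : ℕ → ℤ
  baseA b = - + b

  baseA-step : ∀ b → baseA (suc b) ≡ baseA b - + 1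
  baseA-step b = trans (cong -_ (pos-+ 1 b)) (negate (+ b))
    where
    negate : ∀ x → - (+ 1 + x) ≡ - x - + 1
    negate = solve-∀

  detA′ : ℕ → (ℕ → ℕ) → ℤ
  detA′ m μ = detN m (λ a b → kernelA m (+ μ b + baseA b) a)

  lowerA : ∀ (μ : ℕ → ℕ) m b → b ≤ m → + μ b + - + b + + m ≡ + (μ b ℕ.+ (m ∸ b))
  lowerA μ m b b≤m =
    trans (regroup (+ μ b) (+ b) (+ m)) (trans (cong (_+_ (+ μ b)) (sym (pos-∸ m b b≤m))) (sym (pos-+ (μ b) (m ∸ b))))
    where
    regroup : ∀ u x y → u + - x + y ≡ u + (y - x)
    regroup = solve-∀

  kernelA-boundary : ∀ m → Choices.InvalidChoices.LastColumnBoundary (kernelA m) baseA baseA-step m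
  kernelA-boundary m a e r r<m =
    cong (binomℤ (m ∸ suc r)) (trans (regroup (+ a) (+ r)) (cong -_ (trans (cong (_+_ (+ 1)) (sym (pos-∸ a r r≤a))) (sym (pos-+ 1 (a ∸ r))))))
    where
    r≤a : r ≤ a
    r≤a = ℕP.≤-pred (subst (r ℕ.<_) (sym e) r<m)
    regroup : ∀ x y → - x - + 1 + y ≡ - (+ 1 + (x - y))
    regroup = solve-∀

  -- If the last row of μ is nonempty, then so is every row, and the last row
  -- of the matrix is binom(0, positive) = 0.
  detA′-lastRowNonempty : ∀ m μ → Decreasing (suc m) μ → μ m ≢ 0 → detA′ (suc m) μ ≡ + 0
  detA′-lastRowNonempty m μ dec μm≢0 =
    detN-zeroRow (suc m) (λ a b → kernelA (suc m) (+ μ b + baseA b) a) m (ℕP.n<1+n m) lastRow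
    where
    lastRow : ∀ b → b ℕ.< suc m → kernelA (suc m) (+ μ b + baseA b) m ≡ + 0
    lastRow b (s≤s b≤m) =
      cong₂ binomℤ (ℕP.n∸n≡0 m)
            (trans (lowerA μ m b b≤m) (cong (λ z → + (z ℕ.+ (m ∸ b))) (suc-pred (aboveNonempty m μ dec μm≢0 b b≤m))))

  -- If the last row is empty: the last row of the matrix is the last unit
  -- vector; Pascal's rule splits each remaining column, and multilinearity
  -- gives one determinant per choice, which is detA′ m (ν μ c) or 0.
  detA′-recurrence : ∀ m μ → Decreasing (suc m) μ → μ m ≡ 0 →
    detA′ (suc m) μ ≡ sumChoices m (λ c → onlyIf (validChoice? m μ c) (detA′ m (ν μ c)))
  detA′-recurrence m μ dec μm≡0 = begin
    detN (suc m) M                                   ≡⟨ detN-lastRowUnit m M lastDiagonal lastRowZero ⟩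
    detN m M                                         ≡⟨ detN-ext m split ⟩
    detN m (λ a b → U a b + V a b)                   ≡⟨ multilinear-expand m (detN m) (detN-multilinear m) U V ⟩
    sumChoices m (λ c → detN m (λ a b → select (c b) (U a b) (V a b)))
                                                     ≡⟨ sumChoices-ext m perChoice ⟩
    sumChoices m (λ c → onlyIf (validChoice? m μ c) (detA′ m (ν μ c))) ∎
    where
    open ≡-Reasoning
    open InvalidChoices (kernelA m) baseA baseA-step
    x : ℕ → ℤ
    x b = + μ b + baseA b
    M U V : Mat
    M a b = kernelA (suc m) (x b) a
    U a b = kernelA m (x b) a
    V a b = kernelA m (x b - + 1) a
    lastDiagonal : M m m ≡ + 1
    lastDiagonal = cong₂ binomℤ (ℕP.n∸n≡0 m) (trans (lowerA μ m m ℕP.≤-refl) (cong +_ (cong₂ ℕ._+_ μm≡0 (ℕP.n∸n≡0 m))))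
    lastRowZero : ∀ b → b ℕ.< m → M m b ≡ + 0
    lastRowZero b b<m = cong₂ binomℤ (ℕP.n∸n≡0 m) (trans (lowerA μ m b (ℕP.<⇒≤ b<m))
                          (cong +_ (trans (cong (μ b ℕ.+_) (∸-suc m b b<m)) (ℕP.+-suc (μ b) (m ∸ suc b)))))
    shift : ∀ y a → y + a - + 1 ≡ y - + 1 + a
    shift = solve-∀
    split : ∀ a b → a ℕ.< m → b ℕ.< m → M a b ≡ U a b + V a b
    split a b a<m _ = trans (cong (λ h → binomℤ h (x b + + a)) (∸-suc m a a<m))
                        (trans (binomℤ-pascal (m ∸ suc a) (x b + + a)) (cong (λ z → U a b + binomℤ (m ∸ suc a) z) (shift (x b) (+ a))))
    atChoice : ∀ c → (d : Dec (ValidChoice m μ c)) → detN m (ChoiceMatrix m μ c) ≡ onlyIf d (detA′ m (ν μ c))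
    atChoice c (yes valid)   = detN-ext m (λ a b _ b<m → cong (λ z → kernelA m z a) (colParam-valid m μ c baseA (proj₁ valid) b b<m))
    atChoice c (no  invalid) = invalidChoice⇒vanish m μ c (λ a sa<m → dec a (ℕP.m<n⇒m<1+n sa<m)) (kernelA-boundary m) invalid
    perChoice : ∀ c → detN m (λ a b → select (c b) (U a b) (V a b)) ≡ onlyIf (validChoice? m μ c) (detA′ m (ν μ c))
    perChoice c = trans (detN-ext m (λ a b _ _ → select-colParam (kernelA m) baseA μ c a b)) (atChoice c (validChoice? m μ c))

  -- Second determinant: entry (a, b) is binom(2m-2-2a, μ b + m - 1 - b).
  kernelB : ℕ → ℤ → ℕ → ℤ
  kernelB m z a = binomℤ (2 ℕ.* m ∸ 2 ℕ.* suc a) z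

  baseB : ℕ → ℕ → ℤ
  baseB m b = + m - + suc b

  baseB-step : ∀ m b → baseB m (suc b) ≡ baseB m b - + 1
  baseB-step m b = trans (cong (_-_ (+ m)) (pos-+ 1 (suc b))) (regroup (+ m) (+ suc b))
    where
    regroup : ∀ x y → x - (+ 1 + y) ≡ x - y - + 1
    regroup = solve-∀

  detB′ : ℕ → (ℕ → ℕ) → ℤ
  detB′ m μ = detN m (λ a b → binomℤ (2 ℕ.* m ∸ 2 ℕ.* suc a) (+ (μ b ℕ.+ m ∸ suc b)))

  lowerB : ∀ u m b → suc b ≤ m → + (u ℕ.+ m ∸ suc b) ≡ + u + baseB m b
  lowerB u m b sb≤m = trans (cong +_ (ℕP.+-∸-assoc u sb≤m)) (trans (pos-+ u (m ∸ suc b)) (cong (_+_ (+ u)) (pos-∸ m (suc b) sb≤m)))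

  kernelB-boundary : ∀ m → Choices.InvalidChoices.LastColumnBoundary (kernelB m) (baseB m) (baseB-step m) m
  kernelB-boundary m a e r r<m =
    cong (binomℤ (2 ℕ.* m ∸ 2 ℕ.* suc r)) (trans (cong (λ z → + z - + suc a - + 1) (sym e)) (cancel (+ suc a)))
    where
    cancel : ∀ x → x - x - + 1 ≡ -[1+ 0 ]
    cancel = solve-∀

  -- With a nonempty last row of μ, row m of the matrix is binom(0, positive) = 0.
  detB′-lastRowNonempty : ∀ m μ → Decreasing (suc m) μ → μ m ≢ 0 → detB′ (suc m) μ ≡ + 0
  detB′-lastRowNonempty m μ dec μm≢0 =
    detN-zeroRow (suc m) (λ a b → binomℤ (2 ℕ.* suc m ∸ 2 ℕ.* suc a) (+ (μ b ℕ.+ suc m ∸ suc b))) m (ℕP.n<1+n m) lastRow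
    where
    lastRow : ∀ b → b ℕ.< suc m → binomℤ (2 ℕ.* suc m ∸ 2 ℕ.* suc m) (+ (μ b ℕ.+ suc m ∸ suc b)) ≡ + 0
    lastRow b (s≤s b≤m) =
      cong₂ binomℤ (ℕP.n∸n≡0 (2 ℕ.* suc m))
            (cong +_ (trans (cong (λ z → z ℕ.+ suc m ∸ suc b) (suc-pred (aboveNonempty m μ dec μm≢0 b b≤m)))
                     (trans (ℕP.+-∸-assoc (μ b ∸ 1) (ℕP.m≤n⇒m≤1+n b≤m))
                     (trans (cong ((μ b ∸ 1) ℕ.+_) (ℕP.+-∸-assoc 1 b≤m)) (ℕP.+-suc (μ b ∸ 1) (m ∸ b))))))

  2*-step : ∀ m a → a ℕ.< m → 2 ℕ.* suc m ∸ 2 ℕ.* suc a ≡ suc (suc (2 ℕ.* m ∸ 2 ℕ.* suc a))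
  2*-step m a a<m = begin
    2 ℕ.* suc m ∸ 2 ℕ.* suc a         ≡⟨ sym (ℕP.*-distribˡ-∸ 2 (suc m) (suc a)) ⟩
    2 ℕ.* (m ∸ a)                     ≡⟨ cong (2 ℕ.*_) (∸-suc m a a<m) ⟩
    2 ℕ.* suc (m ∸ suc a)             ≡⟨ ℕP.*-suc 2 (m ∸ suc a) ⟩
    suc (suc (2 ℕ.* (m ∸ suc a)))     ≡⟨ cong (λ z → suc (suc z)) (ℕP.*-distribˡ-∸ 2 m (suc a)) ⟩
    suc (suc (2 ℕ.* m ∸ 2 ℕ.* suc a)) ∎
    where open ≡-Reasoning

  detB′-difference-split : ∀ m (μ : ℕ → ℕ) a b → a ℕ.< m → b ℕ.< m →
    let M = λ a b → binomℤ (2 ℕ.* suc m ∸ 2 ℕ.* suc a) (+ (μ b ℕ.+ suc m ∸ suc b)) in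
    differenceRows m M a b ≡ + 2 * kernelB m (+ μ b + baseB m b) a + kernelB m (+ μ b + baseB m b - + 1) a
  detB′-difference-split m μ a b a<m b<m =
    trans (differenceRows-< m _ a b a<m)
      (trans (cong₂ (λ h₁ h₂ → binomℤ h₁ y - binomℤ h₂ y) (2*-step m a a<m) (cong₂ _∸_ (ℕP.*-suc 2 m) (ℕP.*-suc 2 (suc a))))
        (trans (binomℤ-pascal₂ (2 ℕ.* m ∸ 2 ℕ.* suc a) y)
               (cong (λ z → + 2 * binomℤ (2 ℕ.* m ∸ 2 ℕ.* suc a) z + binomℤ (2 ℕ.* m ∸ 2 ℕ.* suc a) (z - + 1)) lowered)))
    where
    y : ℤ
    y = + (μ b ℕ.+ suc m ∸ suc b)
    regroup : ∀ u m′ sb → u + (+ 1 + m′ - sb) - + 1 ≡ u + (m′ - sb)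
    regroup = solve-∀
    lowered : y - + 1 ≡ + μ b + baseB m b
    lowered = trans (cong (_- + 1) (lowerB (μ b) (suc m) b (s≤s (ℕP.<⇒≤ b<m))))
                (trans (cong (λ z → + μ b + (z - + suc b) - + 1) (pos-+ 1 m)) (regroup (+ μ b) (+ m) (+ suc b)))

  -- As for detA′, after first subtracting consecutive rows; the factor 2 of
  -- every U-column contributes 2^(#unmarked rows).
  detB′-recurrence : ∀ m μ → Decreasing (suc m) μ → μ m ≡ 0 →
    detB′ (suc m) μ ≡ sumChoices m (λ c → (+ 2) ℤ.^ countFalse m c * onlyIf (validChoice? m μ c) (detB′ m (ν μ c)))
  detB′-recurrence m μ dec μm≡0 = begin
    detN (suc m) M                                  ≡⟨ sym (detN-differenceRows (suc m) M m (ℕP.n<1+n m)) ⟩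
    detN (suc m) (differenceRows m M)               ≡⟨ detN-lastRowUnit m (differenceRows m M) lastDiagonal lastRowZero ⟩
    detN m (differenceRows m M)                     ≡⟨ detN-ext m (detB′-difference-split m μ) ⟩
    detN m (λ a b → + 2 * U a b + V a b)            ≡⟨ multilinear-expand m (detN m) (detN-multilinear m) (λ a b → + 2 * U a b) V ⟩
    sumChoices m (λ c → detN m (λ a b → select (c b) (+ 2 * U a b) (V a b)))
                                                    ≡⟨ sumChoices-ext m perChoice ⟩
    sumChoices m (λ c → (+ 2) ℤ.^ countFalse m c * onlyIf (validChoice? m μ c) (detB′ m (ν μ c))) ∎
    where
    open ≡-Reasoning
    open InvalidChoices (kernelB m) (baseB m) (baseB-step m)
    M U V : Mat
    M a b = binomℤ (2 ℕ.* suc m ∸ 2 ℕ.* suc a) (+ (μ b ℕ.+ suc m ∸ suc b))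
    U a b = kernelB m (+ μ b + baseB m b) a
    V a b = kernelB m (+ μ b + baseB m b - + 1) a
    lastDiagonal : differenceRows m M m m ≡ + 1
    lastDiagonal = trans (differenceRows-≥ m M m m ℕP.≤-refl)
      (cong₂ binomℤ (ℕP.n∸n≡0 (2 ℕ.* suc m)) (cong +_ (trans (cong (λ z → z ℕ.+ suc m ∸ suc m) μm≡0) (ℕP.n∸n≡0 (suc m)))))
    lastRowZero : ∀ b → b ℕ.< m → differenceRows m M m b ≡ + 0
    lastRowZero b b<m = trans (differenceRows-≥ m M m b ℕP.≤-refl)
      (cong₂ binomℤ (ℕP.n∸n≡0 (2 ℕ.* suc m))
             (cong +_ (trans (ℕP.+-∸-assoc (μ b) (s≤s (ℕP.<⇒≤ b<m))) (trans (cong (μ b ℕ.+_) (∸-suc m b b<m)) (ℕP.+-suc (μ b) (m ∸ suc b))))))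
    atChoice : ∀ c → (d : Dec (ValidChoice m μ c)) → detN m (ChoiceMatrix m μ c) ≡ onlyIf d (detB′ m (ν μ c))
    atChoice c (yes valid)   = detN-ext m (λ a b _ b<m →
      trans (cong (λ z → kernelB m z a) (colParam-valid m μ c (baseB m) (proj₁ valid) b b<m))
            (cong (binomℤ (2 ℕ.* m ∸ 2 ℕ.* suc a)) (sym (lowerB (ν μ c b) m b b<m))))
    atChoice c (no  invalid) = invalidChoice⇒vanish m μ c (λ a sa<m → dec a (ℕP.m<n⇒m<1+n sa<m)) (kernelB-boundary m) invalid
    perChoice : ∀ c → detN m (λ a b → select (c b) (+ 2 * U a b) (V a b))
                    ≡ (+ 2) ℤ.^ countFalse m c * onlyIf (validChoice? m μ c) (detB′ m (ν μ c))
    perChoice c = trans (multilinear-scale m (detN m) (detN-multilinear m) c (+ 2) U V)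
      (cong ((+ 2) ℤ.^ countFalse m c *_)
            (trans (detN-ext m (λ a b _ _ → select-colParam (kernelB m) (baseB m) μ c a b)) (atChoice c (validChoice? m μ c))))

-- (5) An explicit list of reverse flagged fillings.  Fillings for n rows
-- are stored as n × n grids; `at` reads a grid at ℕ positions (0 outside).
module Enumeration where
  open Multilinear
  open Choices

  Grid : ℕ → Set
  Grid m = Vec (Vec ℕ m) m

  lookup₀ : ∀ {n} → Vec ℕ n → ℕ → ℕ
  lookup₀ []       a       = 0
  lookup₀ (x ∷ xs) zero    = x
  lookup₀ (x ∷ xs) (suc a) = lookup₀ xs a

  lookupRow : ∀ {n m} → Vec (Vec ℕ m) n → ℕ → Vec ℕ m
  lookupRow []       a       = replicate _ 0
  lookupRow (x ∷ xs) zero    = x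
  lookupRow (x ∷ xs) (suc a) = lookupRow xs a

  at : ∀ {m} → Grid m → ℕ → ℕ → ℕ
  at T a b = lookup₀ (lookupRow T a) b

  grid : ∀ m → (ℕ → ℕ → ℕ) → Grid m
  grid m F = tabulate (λ i → tabulate (λ j → F (toℕ i) (toℕ j)))

  inRow : ℕ → ℕ → ℕ
  inRow b k with b ℕ.<? k
  ... | yes _ = 1
  ... | no  _ = 0

  inRow-< : ∀ b k → b ℕ.< k → inRow b k ≡ 1
  inRow-< b k b<k with b ℕ.<? k
  ... | yes _   = refl
  ... | no  b≮k = ⊥-elim (b≮k b<k)

  inRow-≥ : ∀ b k → k ≤ b → inRow b k ≡ 0
  inRow-≥ b k k≤b with b ℕ.<? k
  ... | yes b<k = ⊥-elim (ℕP.<-irrefl refl (ℕP.<-≤-trans b<k k≤b))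
  ... | no  _   = refl

  -- Raise every entry of T by one inside the shape μ, in a grid one size
  -- larger: this inverts the removal of the entries 1.
  raise : ∀ m → (ℕ → ℕ) → Grid m → Grid (suc m)
  raise m μ T = grid (suc m) (λ a b → at T a b ℕ.+ inRow b (μ a))

  concatChoices : ∀ {X : Set} → ℕ → (Choice → List X) → List X
  concatChoices zero    F = F (λ _ → false)
  concatChoices (suc k) F = concatChoices k (λ c → F (consChoice false c)) ++ concatChoices k (λ c → F (consChoice true c))

  keepIf : ∀ {P : Set} {X : Set} → Dec P → List X → List X
  keepIf (yes _) xs = xs
  keepIf (no  _) xs = []

  fillings : (m : ℕ) → (ℕ → ℕ) → List (Grid m)
  fillings zero    μ = [] ∷ []
  fillings (suc m) μ = keepIf (μ m ℕ.≟ 0) (concatChoices m (λ c → keepIf (validChoice? m μ c) (map (raise m μ) (fillings m (ν μ c)))))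

  count : ℕ → (ℕ → ℕ) → ℕ
  count m μ = length (fillings m μ)

  length-concatChoices : ∀ {X : Set} k (F : Choice → List X) → + length (concatChoices k F) ≡ sumChoices k (λ c → + length (F c))
  length-concatChoices zero    F = refl
  length-concatChoices (suc k) F =
    trans (cong +_ (ListP.length-++ (concatChoices k (λ c → F (consChoice false c)))))
      (trans (pos-+ (length (concatChoices k F₀)) (length (concatChoices k F₁)))
             (cong₂ _+_ (length-concatChoices k F₀) (length-concatChoices k F₁)))
    where
    F₀ F₁ : Choice → List _
    F₀ c = F (consChoice false c)
    F₁ c = F (consChoice true c)

  concatChoices-[] : ∀ {X : Set} k (F : Choice → List X) → (∀ c → F c ≡ []) → concatChoices k F ≡ []
  concatChoices-[] zero    F h = h _
  concatChoices-[] (suc k) F h = cong₂ _++_ (concatChoices-[] k _ (λ c → h _)) (concatChoices-[] k _ (λ c → h _))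

  count-lastRowNonempty : ∀ m μ → μ m ≢ 0 → count (suc m) μ ≡ 0
  count-lastRowNonempty m μ μm≢0 with μ m ℕ.≟ 0
  ... | yes μm≡0 = ⊥-elim (μm≢0 μm≡0)
  ... | no  _    = refl

  count-recurrence : ∀ m μ → μ m ≡ 0 → + count (suc m) μ ≡ sumChoices m (λ c → onlyIf (validChoice? m μ c) (+ count m (ν μ c)))
  count-recurrence m μ μm≡0 with μ m ℕ.≟ 0
  ... | no  μm≢0 = ⊥-elim (μm≢0 μm≡0)
  ... | yes _    = trans (length-concatChoices m _) (sumChoices-ext m (λ c → perChoice c (validChoice? m μ c)))
    where
    perChoice : ∀ c (d : Dec (ValidChoice m μ c)) → + length (keepIf d (map (raise m μ) (fillings m (ν μ c)))) ≡ onlyIf d (+ count m (ν μ c))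
    perChoice c (yes _) = cong +_ (ListP.length-map (raise m μ) (fillings m (ν μ c)))
    perChoice c (no  _) = refl

  Staircase : ℕ → (ℕ → ℕ) → Set
  Staircase m μ = ∀ a → a ℕ.< m → μ a ℕ.+ a ℕ.< m

  -- Outside the staircase there are no fillings (a row a with μ a + a ≥ m
  -- survives every removal step until it reaches the last row).
  fillings-outsideStaircase : ∀ m μ a → a ℕ.< m → m ≤ μ a ℕ.+ a → fillings m μ ≡ []
  fillings-outsideStaircase (suc m) μ a a<1+m tooLong with μ m ℕ.≟ 0
  ... | no  _    = refl
  ... | yes μm≡0 = concatChoices-[] m _ perChoice
    where
    a<m : a ℕ.< m
    a<m with ℕP.m≤n⇒m<n∨m≡n (ℕP.≤-pred a<1+m)
    ... | inj₁ p    = p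
    ... | inj₂ refl = ⊥-elim (ℕP.<-irrefl refl (subst (λ z → suc a ≤ z ℕ.+ a) μm≡0 tooLong))
    stillTooLong : ∀ x y → y ≤ 1 → suc m ≤ x ℕ.+ a → m ≤ (x ∸ y) ℕ.+ a
    stillTooLong zero    y             _        p       = ⊥-elim (ℕP.<-asym a<m (ℕP.<-≤-trans (ℕP.n<1+n m) p))
    stillTooLong (suc k) zero          _        (s≤s p) = ℕP.≤-trans p (ℕP.n≤1+n (k ℕ.+ a))
    stillTooLong (suc k) (suc zero)    _        (s≤s p) = p
    stillTooLong (suc k) (suc (suc y)) (s≤s ()) p
    perChoice : ∀ c → keepIf (validChoice? m μ c) (map (raise m μ) (fillings m (ν μ c))) ≡ []
    perChoice c with validChoice? m μ c
    ... | no  _ = refl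
    ... | yes _ = cong (map (raise m μ))
                       (fillings-outsideStaircase m (ν μ c) a a<m (stillTooLong (μ a) (bit (c a)) (bit≤1 (c a)) tooLong))

  staircase-or-empty : ∀ m μ → Staircase m μ ⊎ (fillings m μ ≡ [])
  staircase-or-empty m μ with searchBelow m (λ a → μ a ℕ.+ a ℕ.< m) (λ a → μ a ℕ.+ a ℕ.<? m)
  ... | inj₁ staircase             = inj₁ staircase
  ... | inj₂ (a , a<m , ¬fits) = inj₂ (fillings-outsideStaircase m μ a a<m (ℕP.≮⇒≥ ¬fits))

module Counting where
  open Multilinear
  open Choices
  open Recurrences
  open Enumeration

  boxes : ℕ → (ℕ → ℕ) → ℕ
  boxes zero    μ = 0
  boxes (suc m) μ = μ 0 ℕ.+ boxes m (λ a → μ (suc a))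

  countTrue : ℕ → Choice → ℕ
  countTrue zero    c = 0
  countTrue (suc k) c = bit (c 0) ℕ.+ countTrue k (λ a → c (suc a))

  boxes-snoc : ∀ m μ → boxes (suc m) μ ≡ boxes m μ ℕ.+ μ m
  boxes-snoc zero    μ = ℕP.+-comm (μ 0) 0
  boxes-snoc (suc m) μ = trans (cong (μ 0 ℕ.+_) (boxes-snoc m (λ a → μ (suc a)))) (sym (ℕP.+-assoc (μ 0) _ _))

  boxes-ν : ∀ m μ c → Removable m μ c → boxes m μ ≡ boxes m (ν μ c) ℕ.+ countTrue m c
  boxes-ν zero    μ c removable = refl
  boxes-ν (suc m) μ c removable =
    trans (cong₂ ℕ._+_ (firstRow (c 0) (removable 0 (s≤s z≤n)))
                       (boxes-ν m (λ a → μ (suc a)) (λ a → c (suc a)) (λ a p → removable (suc a) (s≤s p))))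
          (interchange (μ 0 ∸ bit (c 0)) (bit (c 0)) _ _)
    where
    firstRow : ∀ b → (b ≡ false ⊎ 1 ≤ μ 0) → μ 0 ≡ (μ 0 ∸ bit b) ℕ.+ bit b
    firstRow false _        = sym (ℕP.+-identityʳ (μ 0))
    firstRow true  (inj₂ p) = sym (ℕP.m∸n+n≡m p)
    interchange : ∀ x y z w → x ℕ.+ y ℕ.+ (z ℕ.+ w) ≡ x ℕ.+ z ℕ.+ (y ℕ.+ w)
    interchange = ℕSolver.solve-∀

  countFalse+countTrue : ∀ m c → countFalse m c ℕ.+ countTrue m c ≡ m
  countFalse+countTrue zero    c = refl
  countFalse+countTrue (suc m) c with c 0
  ... | true  = trans (ℕP.+-suc (countFalse m (λ a → c (suc a))) _) (cong suc (countFalse+countTrue m (λ a → c (suc a))))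
  ... | false = cong suc (countFalse+countTrue m (λ a → c (suc a)))

  suc-C-2 : ∀ m → suc m C 2 ≡ m ℕ.+ m C 2
  suc-C-2 m = trans (sym (nCk+nC[k+1]≡[n+1]C[k+1] m 1)) (cong (ℕ._+ m C 2) (nC1≡n m))

  boxes-staircase : ∀ m μ → Staircase m μ → boxes m μ ≤ m C 2
  boxes-staircase zero    μ st = z≤n
  boxes-staircase (suc m) μ st =
    subst (boxes (suc m) μ ≤_) (sym (suc-C-2 m))
      (ℕP.+-mono-≤ (ℕP.≤-pred (subst (ℕ._< suc m) (ℕP.+-identityʳ (μ 0)) (st 0 (s≤s z≤n))))
                   (boxes-staircase m (λ a → μ (suc a)) tail))
    where
    tail : Staircase m (λ a → μ (suc a))
    tail a a<m = ℕP.≤-pred (subst (ℕ._< suc m) (ℕP.+-suc (μ (suc a)) a) (st (suc a) (s≤s a<m)))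

  exponent-step : ∀ m μ c → μ m ≡ 0 → Removable m μ c → Staircase m (ν μ c) →
    countFalse m c ℕ.+ (m C 2 ∸ boxes m (ν μ c)) ≡ suc m C 2 ∸ boxes (suc m) μ
  exponent-step m μ c μm≡0 removable st = sym (begin
    suc m C 2 ∸ boxes (suc m) μ
      ≡⟨ cong₂ _∸_ (suc-C-2 m) (trans (boxes-snoc m μ) (trans (cong (boxes m μ ℕ.+_) μm≡0)
                                  (trans (ℕP.+-identityʳ (boxes m μ)) (boxes-ν m μ c removable)))) ⟩
    m ℕ.+ m C 2 ∸ (boxes m ν′ ℕ.+ t)
      ≡⟨ cong (λ z → z ℕ.+ m C 2 ∸ (boxes m ν′ ℕ.+ t)) (sym (countFalse+countTrue m c)) ⟩
    f ℕ.+ t ℕ.+ m C 2 ∸ (boxes m ν′ ℕ.+ t)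
      ≡⟨ cong₂ _∸_ (regroup f t (m C 2)) (ℕP.+-comm (boxes m ν′) t) ⟩
    t ℕ.+ (f ℕ.+ m C 2) ∸ (t ℕ.+ boxes m ν′)
      ≡⟨ ℕP.[m+n]∸[m+o]≡n∸o t (f ℕ.+ m C 2) (boxes m ν′) ⟩
    f ℕ.+ m C 2 ∸ boxes m ν′
      ≡⟨ ℕP.+-∸-assoc f (boxes-staircase m ν′ st) ⟩
    f ℕ.+ (m C 2 ∸ boxes m ν′) ∎)
    where
    open ≡-Reasoning
    ν′ : ℕ → ℕ
    ν′ = ν μ c
    f : ℕ
    f = countFalse m c
    t : ℕ
    t = countTrue m c
    regroup : ∀ f t k → f ℕ.+ t ℕ.+ k ≡ t ℕ.+ (f ℕ.+ k)
    regroup = ℕSolver.solve-∀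

  pow-pos : ∀ k → (+ 2) ℤ.^ k ≡ + (2 ^ k)
  pow-pos zero    = refl
  pow-pos (suc k) = trans (cong (+ 2 *_) (pow-pos k)) (sym (pos-* 2 (2 ^ k)))

  detA′≡count : ∀ m μ → Decreasing m μ → detA′ m μ ≡ + count m μ
  detA′≡count zero    μ dec = refl
  detA′≡count (suc m) μ dec = byLastRow (μ m ℕ.≟ 0)
    where
    perChoice : ∀ c (d : Dec (ValidChoice m μ c)) → onlyIf d (detA′ m (ν μ c)) ≡ onlyIf d (+ count m (ν μ c))
    perChoice c (yes valid) = detA′≡count m (ν μ c) (validChoice-decreasing m μ c valid)
    perChoice c (no  _)     = refl
    byLastRow : Dec (μ m ≡ 0) → detA′ (suc m) μ ≡ + count (suc m) μ
    byLastRow (no  μm≢0) = trans (detA′-lastRowNonempty m μ dec μm≢0) (cong +_ (sym (count-lastRowNonempty m μ μm≢0)))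
    byLastRow (yes μm≡0) =
      trans (detA′-recurrence m μ dec μm≡0)
        (trans (sumChoices-ext m (λ c → perChoice c (validChoice? m μ c))) (sym (count-recurrence m μ μm≡0)))

  weightB : ℕ → (ℕ → ℕ) → ℤ
  weightB m μ = + (2 ^ (m C 2 ∸ boxes m μ))

  weightB-step : ∀ m μ c → μ m ≡ 0 → ValidChoice m μ c →
    (+ 2) ℤ.^ countFalse m c * (weightB m (ν μ c) * + count m (ν μ c)) ≡ weightB (suc m) μ * + count m (ν μ c)
  weightB-step m μ c μm≡0 valid with staircase-or-empty m (ν μ c)
  ... | inj₁ st = trans (sym (*-assoc ((+ 2) ℤ.^ k) _ _)) (cong (_* + count m (ν μ c))
      (trans (cong (_* weightB m (ν μ c)) (pow-pos k))
        (trans (sym (pos-* (2 ^ k) _))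
          (cong +_ (trans (sym (ℕP.^-distribˡ-+-* 2 k _)) (cong (2 ^_) (exponent-step m μ c μm≡0 (proj₁ valid) st)))))))
    where k = countFalse m c
  ... | inj₂ none rewrite none = trans (cong ((+ 2) ℤ.^ countFalse m c *_) (*-zeroʳ (weightB m (ν μ c))))
                                  (trans (*-zeroʳ ((+ 2) ℤ.^ countFalse m c)) (sym (*-zeroʳ (weightB (suc m) μ))))

  detB′≡weighted-count : ∀ m μ → Decreasing m μ → detB′ m μ ≡ weightB m μ * + count m μ
  detB′≡weighted-count zero    μ dec = refl
  detB′≡weighted-count (suc m) μ dec = byLastRow (μ m ℕ.≟ 0)
    where
    w : ℤ
    w = weightB (suc m) μ
    perChoice : μ m ≡ 0 → ∀ c (d : Dec (ValidChoice m μ c)) →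
      (+ 2) ℤ.^ countFalse m c * onlyIf d (detB′ m (ν μ c)) ≡ w * onlyIf d (+ count m (ν μ c))
    perChoice μm≡0 c (yes valid) =
      trans (cong ((+ 2) ℤ.^ countFalse m c *_) (detB′≡weighted-count m (ν μ c) (validChoice-decreasing m μ c valid)))
            (weightB-step m μ c μm≡0 valid)
    perChoice μm≡0 c (no  _) = trans (*-zeroʳ ((+ 2) ℤ.^ countFalse m c)) (sym (*-zeroʳ w))
    byLastRow : Dec (μ m ≡ 0) → detB′ (suc m) μ ≡ w * + count (suc m) μ
    byLastRow (no  μm≢0) =
      trans (detB′-lastRowNonempty m μ dec μm≢0)
            (trans (sym (*-zeroʳ w)) (cong (λ z → w * + z) (sym (count-lastRowNonempty m μ μm≢0))))
    byLastRow (yes μm≡0) =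
      trans (detB′-recurrence m μ dec μm≡0)
        (trans (sumChoices-ext m (λ c → perChoice μm≡0 c (validChoice? m μ c)))
          (trans (sumChoices-* m w _) (cong (w *_) (sym (count-recurrence m μ μm≡0)))))

module GridFacts where
  open Enumeration

  lookup₀-lookup : ∀ {n} (v : Vec ℕ n) (i : Fin n) → lookup₀ v (toℕ i) ≡ lookup v i
  lookup₀-lookup (x ∷ v) fzero    = refl
  lookup₀-lookup (x ∷ v) (fsuc i) = lookup₀-lookup v i

  lookupRow-lookup : ∀ {n m} (v : Vec (Vec ℕ m) n) (i : Fin n) → lookupRow v (toℕ i) ≡ lookup v i
  lookupRow-lookup (x ∷ v) fzero    = refl
  lookupRow-lookup (x ∷ v) (fsuc i) = lookupRow-lookup v i

  at-entry : ∀ {m} (T : Grid m) (i j : Fin m) → at T (toℕ i) (toℕ j) ≡ entry T i j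
  at-entry T i j = trans (cong (λ r → lookup₀ r (toℕ j)) (lookupRow-lookup T i)) (lookup₀-lookup (lookup T i) j)

  at-fromℕ< : ∀ {m} (T : Grid m) a b (a<m : a ℕ.< m) (b<m : b ℕ.< m) → at T a b ≡ entry T (fromℕ< a<m) (fromℕ< b<m)
  at-fromℕ< T a b a<m b<m = trans (cong₂ (at T) (sym (toℕ-fromℕ< a<m)) (sym (toℕ-fromℕ< b<m))) (at-entry T (fromℕ< a<m) (fromℕ< b<m))

  lookup₀-outside : ∀ {n} (v : Vec ℕ n) b → n ≤ b → lookup₀ v b ≡ 0
  lookup₀-outside []      b       _       = refl
  lookup₀-outside (x ∷ v) (suc b) (s≤s p) = lookup₀-outside v b p

  lookup₀-replicate : ∀ n b → lookup₀ (replicate n 0) b ≡ 0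
  lookup₀-replicate zero    b       = refl
  lookup₀-replicate (suc n) zero    = refl
  lookup₀-replicate (suc n) (suc b) = lookup₀-replicate n b

  at-outsideRows : ∀ {m} (T : Grid m) a b → m ≤ a → at T a b ≡ 0
  at-outsideRows T a b = rows T a
    where
    rows : ∀ {n k} (v : Vec (Vec ℕ k) n) a → n ≤ a → lookup₀ (lookupRow v a) b ≡ 0
    rows {k = k} []      a       _       = lookup₀-replicate k b
    rows         (x ∷ v) (suc a) (s≤s p) = rows v a p

  at-outsideColumns : ∀ {m} (T : Grid m) a b → m ≤ b → at T a b ≡ 0
  at-outsideColumns T a b = lookup₀-outside (lookupRow T a) b

  at-grid : ∀ m F a b → a ℕ.< m → b ℕ.< m → at (grid m F) a b ≡ F a b
  at-grid m F a b a<m b<m = trans (at-fromℕ< (grid m F) a b a<m b<m)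
    (trans (trans (cong (λ r → lookup r (fromℕ< b<m)) (VecP.lookup∘tabulate (λ i → tabulate (λ j → F (toℕ i) (toℕ j))) (fromℕ< a<m)))
                  (VecP.lookup∘tabulate (λ j → F (toℕ (fromℕ< a<m)) (toℕ j)) (fromℕ< b<m)))
           (cong₂ F (toℕ-fromℕ< a<m) (toℕ-fromℕ< b<m)))

  vec-ext : ∀ {A : Set} {n} (v w : Vec A n) → (∀ i → lookup v i ≡ lookup w i) → v ≡ w
  vec-ext v w h = trans (sym (VecP.tabulate∘lookup v)) (trans (VecP.tabulate-cong h) (VecP.tabulate∘lookup w))

  grid-ext : ∀ {m} (T T′ : Grid m) → (∀ a b → a ℕ.< m → b ℕ.< m → at T a b ≡ at T′ a b) → T ≡ T′
  grid-ext T T′ h = vec-ext T T′ (λ i → vec-ext _ _ (λ j →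
    trans (sym (at-entry T i j)) (trans (h _ _ (toℕ<n i) (toℕ<n j)) (at-entry T′ i j))))

  raise-at : ∀ m μ (T : Grid m) a b → a ℕ.< suc m → b ℕ.< suc m → at (raise m μ T) a b ≡ at T a b ℕ.+ inRow b (μ a)
  raise-at m μ T = at-grid (suc m) (λ a b → at T a b ℕ.+ inRow b (μ a))

  raise-injective : ∀ m μ (T₁ T₂ : Grid m) → raise m μ T₁ ≡ raise m μ T₂ → T₁ ≡ T₂
  raise-injective m μ T₁ T₂ e = grid-ext T₁ T₂ (λ a b a<m b<m →
    ℕP.+-cancelʳ-≡ (inRow b (μ a)) (at T₁ a b) (at T₂ a b)
      (trans (sym (raise-at m μ T₁ a b (ℕP.m<n⇒m<1+n a<m) (ℕP.m<n⇒m<1+n b<m)))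
        (trans (cong (λ T → at T a b) e) (raise-at m μ T₂ a b (ℕP.m<n⇒m<1+n a<m) (ℕP.m<n⇒m<1+n b<m)))))

module ListFacts where
  open Multilinear using (Choice; consChoice)
  open Enumeration using (concatChoices; keepIf)

  truncate : ℕ → Choice → Choice
  truncate zero    c = λ _ → false
  truncate (suc k) c = consChoice (c 0) (truncate k (λ a → c (suc a)))

  truncate-< : ∀ k c a → a ℕ.< k → truncate k c a ≡ c a
  truncate-< (suc k) c zero    _       = refl
  truncate-< (suc k) c (suc a) (s≤s p) = truncate-< k (λ a → c (suc a)) a p

  module _ {X : Set} where

    concatChoices-∈⁺ : ∀ k (F : Choice → List X) c x → x ∈ F (truncate k c) → x ∈ concatChoices k F
    concatChoices-∈⁺ zero    F c x p = p
    concatChoices-∈⁺ (suc k) F c x p with c 0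
    ... | false = ∈-++⁺ˡ (concatChoices-∈⁺ k (λ c′ → F (consChoice false c′)) (λ a → c (suc a)) x p)
    ... | true  = ∈-++⁺ʳ (concatChoices k (λ c′ → F (consChoice false c′)))
                         (concatChoices-∈⁺ k (λ c′ → F (consChoice true c′)) (λ a → c (suc a)) x p)

    concatChoices-∈⁻ : ∀ k (F : Choice → List X) x → x ∈ concatChoices k F → Σ Choice λ c → x ∈ F c
    concatChoices-∈⁻ zero    F x p = _ , p
    concatChoices-∈⁻ (suc k) F x p with ∈-++⁻ (concatChoices k (λ c′ → F (consChoice false c′))) p
    ... | inj₁ q = let (c , r) = concatChoices-∈⁻ k _ x q in consChoice false c , r
    ... | inj₂ q = let (c , r) = concatChoices-∈⁻ k _ x q in consChoice true c , r

    keepIf-∈⁻ : ∀ {P : Set} (d : Dec P) (xs : List X) x → x ∈ keepIf d xs → P × x ∈ xs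
    keepIf-∈⁻ (yes p) xs x q  = p , q
    keepIf-∈⁻ (no _)  xs x ()

    keepIf-∈⁺ : ∀ {P : Set} (d : Dec P) (xs : List X) x → P → x ∈ xs → x ∈ keepIf d xs
    keepIf-∈⁺ (yes _)  xs x p q = q
    keepIf-∈⁺ (no ¬p) xs x p q = ⊥-elim (¬p p)

    keepIf-unique : ∀ {P : Set} (d : Dec P) (xs : List X) → Unique xs → Unique (keepIf d xs)
    keepIf-unique (yes _) xs u = u
    keepIf-unique (no  _) xs u = []

    concatChoices-unique : ∀ k (F : Choice → List X) (choiceOf : X → Choice) → (∀ c → Unique (F c)) →
      (∀ c x → x ∈ F c → ∀ a → a ℕ.< k → choiceOf x a ≡ c a) → Unique (concatChoices k F)
    concatChoices-unique zero    F choiceOf u h = u _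
    concatChoices-unique (suc k) F choiceOf u h =
      Unique.++⁺ (concatChoices-unique k _ (λ x a → choiceOf x (suc a)) (λ c → u _) (λ c x p a a<k → h _ x p (suc a) (s≤s a<k)))
                 (concatChoices-unique k _ (λ x a → choiceOf x (suc a)) (λ c → u _) (λ c x p a a<k → h _ x p (suc a) (s≤s a<k)))
                 disjoint
      where
      disjoint : ∀ {v} → ¬ (v ∈ concatChoices k (λ c → F (consChoice false c)) × v ∈ concatChoices k (λ c → F (consChoice true c)))
      disjoint {v} (p , q) with concatChoices-∈⁻ k _ v p | concatChoices-∈⁻ k _ v q
      ... | (c₁ , p₁) | (c₂ , q₂) with trans (sym (h _ v p₁ 0 (s≤s z≤n))) (h _ v q₂ 0 (s≤s z≤n))
      ...   | ()

module ValidFillings where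
  record ValidFilling (m : ℕ) (μ : ℕ → ℕ) (F : ℕ → ℕ → ℕ) : Set where
    field
      zeroOutside : ∀ a b → a ℕ.< m → b ℕ.< m → μ a ≤ b → F a b ≡ 0
      positive    : ∀ a b → a ℕ.< m → b ℕ.< m → b ℕ.< μ a → 1 ≤ F a b
      flagged     : ∀ a b → a ℕ.< m → b ℕ.< m → b ℕ.< μ a → F a b ≤ m ∸ suc a
      rowStrict   : ∀ a b b′ → a ℕ.< m → b′ ℕ.< m → b ℕ.< b′ → b′ ℕ.< μ a → F a b′ ℕ.< F a b
      colWeak     : ∀ a a′ b → a′ ℕ.< m → b ℕ.< m → a ℕ.< a′ → b ℕ.< μ a′ → F a′ b ≤ F a b

-- Every grid in the list is a filling: raising a filling of ν μ c along a
-- valid choice c gives a filling of μ (the new entries 1 sit at the ends of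
-- the marked rows, all other entries grow by one).
module Soundness where
  open Multilinear using (Choice)
  open Choices
  open Recurrences using (∸-suc)
  open Enumeration
  open GridFacts
  open ListFacts
  open ValidFillings
  open ValidFilling

  module Raised (m : ℕ) (μ : ℕ → ℕ) (c : Choice) (T : Grid m) (dec : Decreasing (suc m) μ)
                (st : Staircase (suc m) μ) (vT : ValidFilling m (ν μ c) (at T)) where
    G : ℕ → ℕ → ℕ
    G = at T
    F : ℕ → ℕ → ℕ
    F = at (raise m μ T)

    G-outside : ∀ a b → (a ℕ.< m → b ℕ.< m → ν μ c a ≤ b) → G a b ≡ 0
    G-outside a b h with a ℕ.<? m | b ℕ.<? m
    ... | yes a<m | yes b<m = zeroOutside vT a b a<m b<m (h a<m b<m)
    ... | no  a≮m | _       = at-outsideRows T a b (ℕP.≮⇒≥ a≮m)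
    ... | yes _   | no  b≮m = at-outsideColumns T a b (ℕP.≮⇒≥ b≮m)

    row< : ∀ a b → a ℕ.< suc m → b ℕ.< μ a → a ℕ.< m
    row< a b p q = ℕP.≤-trans (ℕP.+-monoˡ-≤ a (ℕP.≤-trans (s≤s z≤n) q)) (ℕP.≤-pred (st a p))

    col< : ∀ a b → a ℕ.< suc m → b ℕ.< μ a → b ℕ.< m
    col< a b p q = ℕP.<-≤-trans q (ℕP.≤-trans (ℕP.m≤m+n (μ a) a) (ℕP.≤-pred (st a p)))

    inside : ∀ a b → a ℕ.< suc m → b ℕ.< suc m → b ℕ.< μ a → F a b ≡ G a b ℕ.+ 1
    inside a b p q lt = trans (raise-at m μ T a b p q) (cong (G a b ℕ.+_) (inRow-< b (μ a) lt))

    zeroOutside′ : ∀ a b → a ℕ.< suc m → b ℕ.< suc m → μ a ≤ b → F a b ≡ 0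
    zeroOutside′ a b p q le = trans (raise-at m μ T a b p q)
      (cong₂ ℕ._+_ (G-outside a b (λ _ _ → ℕP.≤-trans (ν≤μ μ c a) le)) (inRow-≥ b (μ a) le))

    positive′ : ∀ a b → a ℕ.< suc m → b ℕ.< suc m → b ℕ.< μ a → 1 ≤ F a b
    positive′ a b p q lt = subst (1 ≤_) (sym (inside a b p q lt)) (ℕP.m≤n+m 1 (G a b))

    -- inside ν μ c the entry grows by one, on a removed box it is 1
    flagged′ : ∀ a b → a ℕ.< suc m → b ℕ.< suc m → b ℕ.< μ a → F a b ≤ suc m ∸ suc a
    flagged′ a b p q lt with b ℕ.<? ν μ c a
    ... | yes bν = subst₂ _≤_ (sym (inside a b p q lt)) (trans (ℕP.+-comm (m ∸ suc a) 1) (sym (∸-suc m a (row< a b p lt))))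
                          (ℕP.+-monoˡ-≤ 1 (flagged vT a b (row< a b p lt) (col< a b p lt) bν))
    ... | no ¬bν = subst₂ _≤_ (sym (trans (inside a b p q lt) (cong (ℕ._+ 1) (G-outside a b (λ _ _ → ℕP.≮⇒≥ ¬bν)))))
                          (sym (∸-suc m a (row< a b p lt))) (s≤s z≤n)

    rowStrict′ : ∀ a b b′ → a ℕ.< suc m → b′ ℕ.< suc m → b ℕ.< b′ → b′ ℕ.< μ a → F a b′ ℕ.< F a b
    rowStrict′ a b b′ p q bb′ lt
      rewrite inside a b′ p q lt | inside a b p (ℕP.<-trans bb′ q) (ℕP.<-trans bb′ lt) with b′ ℕ.<? ν μ c a
    ... | yes b′ν = ℕP.+-monoˡ-< 1 (rowStrict vT a b b′ (row< a b′ p lt) (col< a b′ p lt) bb′ b′ν)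
    ... | no ¬b′ν = subst (ℕ._< G a b ℕ.+ 1) (sym (cong (ℕ._+ 1) (G-outside a b′ (λ _ _ → ℕP.≮⇒≥ ¬b′ν))))
                      (ℕP.+-monoˡ-≤ 1 (positive vT a b (row< a b′ p lt) (ℕP.<-trans bb′ (col< a b′ p lt)) bν))
      where
      bν : b ℕ.< ν μ c a
      bν = ℕP.<-≤-trans bb′ (ℕP.≤-pred (ℕP.≤-trans lt (μ≤1+ν μ c a)))

    colWeak′ : ∀ a a′ b → a′ ℕ.< suc m → b ℕ.< suc m → a ℕ.< a′ → b ℕ.< μ a′ → F a′ b ≤ F a b
    colWeak′ a a′ b p q aa′ lt
      rewrite inside a′ b p q lt
            | inside a b (ℕP.<-trans aa′ p) q (ℕP.<-≤-trans lt (decreasing-mono (suc m) μ dec a a′ (ℕP.<⇒≤ aa′) p))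
            with b ℕ.<? ν μ c a′
    ... | yes bν = ℕP.+-monoˡ-≤ 1 (colWeak vT a a′ b (row< a′ b p lt) (col< a′ b p lt) aa′ bν)
    ... | no ¬bν = ℕP.+-monoˡ-≤ 1 (subst (_≤ G a b) (sym (G-outside a′ b (λ _ _ → ℕP.≮⇒≥ ¬bν))) z≤n)

  raise-valid : ∀ m μ c (T : Grid m) → Decreasing (suc m) μ → Staircase (suc m) μ →
    ValidFilling m (ν μ c) (at T) → ValidFilling (suc m) μ (at (raise m μ T))
  raise-valid m μ c T dec st vT = record
    { zeroOutside = zeroOutside′ ; positive = positive′ ; flagged = flagged′ ; rowStrict = rowStrict′ ; colWeak = colWeak′ }
    where open Raised m μ c T dec st vT

  fillings-sound : ∀ m μ → Decreasing m μ → Staircase m μ → ∀ T → T ∈ fillings m μ → ValidFilling m μ (at T)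
  fillings-sound zero μ dec st T p =
    record { zeroOutside = λ _ _ () ; positive = λ _ _ () ; flagged = λ _ _ () ; rowStrict = λ _ _ _ () ; colWeak = λ _ _ _ () }
  fillings-sound (suc m) μ dec st T p with keepIf-∈⁻ (μ m ℕ.≟ 0) _ T p
  ... | (_ , q) with concatChoices-∈⁻ m _ T q
  ...   | (c , r) with keepIf-∈⁻ (validChoice? m μ c) _ T r
  ...     | (valid , s) with ∈-map⁻ (raise m μ) s
  ...       | (T′ , t , refl) with staircase-or-empty m (ν μ c)
  ...         | inj₂ none = ⊥-elim (¬Any[] (subst (T′ ∈_) none t))
  ...         | inj₁ stν  = raise-valid m μ c T′ dec st
                              (fillings-sound m (ν μ c) (validChoice-decreasing m μ c valid) stν T′ t)

-- No grid occurs twice: raising is injective, and a raised grid remembers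
-- its choice c, as c a = true iff row a is nonempty and ends in a 1.
module Uniqueness where
  open Multilinear using (Choice)
  open Choices
  open Enumeration
  open GridFacts
  open ListFacts
  open ValidFillings
  open ValidFilling
  open Soundness

  endsInOne : ℕ → ℕ → Bool
  endsInOne zero    _ = false
  endsInOne (suc _) v = v ℕ.≡ᵇ 1

  endsInOne-true : ∀ k v → endsInOne k v ≡ true → 1 ≤ k × v ≡ 1
  endsInOne-true (suc k) (suc zero) _ = s≤s z≤n , refl

  endsInOne-false : ∀ k v → endsInOne k v ≡ false → 1 ≤ k → v ≢ 1
  endsInOne-false (suc k) (suc zero) () _ refl

  choiceOf : ∀ {n} → (ℕ → ℕ) → Grid n → Choice
  choiceOf μ T a = endsInOne (μ a) (at T a (μ a ∸ 1))

  pred< : ∀ x → 1 ≤ x → x ∸ 1 ℕ.< x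
  pred< (suc x) _ = ℕP.≤-refl

  -- The last box of row a of the raised grid holds g + 1, where g is the
  -- entry of the smaller filling there: 0 if the row was marked, ≥ 1 if not.
  endsInOne-raised : ∀ (k g : ℕ) (b : Bool) → (b ≡ false ⊎ 1 ≤ k) → (b ≡ true → 1 ≤ k → g ≡ 0) →
    (b ≡ false → 1 ≤ k → 1 ≤ g) → endsInOne k (g ℕ.+ inRow (k ∸ 1) k) ≡ b
  endsInOne-raised zero    g false _          _      _      = refl
  endsInOne-raised zero    g true  (inj₁ ())  _      _
  endsInOne-raised zero    g true  (inj₂ ())  _      _
  endsInOne-raised (suc k) g true  _          marked _ rewrite marked refl (s≤s z≤n) | inRow-< k (suc k) ℕP.≤-refl = refl
  endsInOne-raised (suc k) g false _ _ unmarked rewrite inRow-< k (suc k) ℕP.≤-refl with g | unmarked refl (s≤s z≤n)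
  ... | suc g′ | _ rewrite ℕP.+-comm g′ 1 = refl

  choiceOf-raise : ∀ m μ c → Staircase (suc m) μ → Removable m μ c →
    ∀ T → ValidFilling m (ν μ c) (at T) → ∀ a → a ℕ.< m → choiceOf μ (raise m μ T) a ≡ c a
  choiceOf-raise m μ c st removable T vT a a<m =
    trans (cong (endsInOne (μ a)) (raise-at m μ T a (μ a ∸ 1) (ℕP.m<n⇒m<1+n a<m) (s≤s (ℕP.≤-trans (ℕP.m∸n≤m (μ a) 1) μa≤m))))
          (endsInOne-raised (μ a) (at T a (μ a ∸ 1)) (c a) (removable a a<m) marked unmarked)
    where
    μa≤m : μ a ≤ m
    μa≤m = ℕP.≤-trans (ℕP.m≤m+n (μ a) a) (ℕP.≤-pred (st a (ℕP.m<n⇒m<1+n a<m)))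
    last<m : 1 ≤ μ a → μ a ∸ 1 ℕ.< m
    last<m q = ℕP.<-≤-trans (pred< (μ a) q) μa≤m
    marked : c a ≡ true → 1 ≤ μ a → at T a (μ a ∸ 1) ≡ 0
    marked ca q = zeroOutside vT a (μ a ∸ 1) a<m (last<m q) (ℕP.≤-reflexive (cong (λ z → μ a ∸ bit z) ca))
    unmarked : c a ≡ false → 1 ≤ μ a → 1 ≤ at T a (μ a ∸ 1)
    unmarked ca q = positive vT a (μ a ∸ 1) a<m (last<m q)
                      (subst (μ a ∸ 1 ℕ.<_) (sym (cong (λ z → μ a ∸ bit z) ca)) (pred< (μ a) q))

  fillings-unique : ∀ m μ → Decreasing m μ → Staircase m μ → Unique (fillings m μ)
  fillings-unique zero    μ _   _  = All.[] ∷ []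
  fillings-unique (suc m) μ dec st =
    keepIf-unique (μ m ℕ.≟ 0) _ (concatChoices-unique m block (choiceOf μ) blockUnique recovers)
    where
    block : Choice → List (Grid (suc m))
    block c = keepIf (validChoice? m μ c) (map (raise m μ) (fillings m (ν μ c)))
    smallerUnique : ∀ c → ValidChoice m μ c → Unique (fillings m (ν μ c))
    smallerUnique c valid with staircase-or-empty m (ν μ c)
    ... | inj₁ stν  = fillings-unique m (ν μ c) (validChoice-decreasing m μ c valid) stν
    ... | inj₂ none = subst Unique (sym none) []
    blockUnique : ∀ c → Unique (block c)
    blockUnique c with validChoice? m μ c
    ... | yes valid = Unique.map⁺ (λ {x} {y} → raise-injective m μ x y) (smallerUnique c valid)
    ... | no  _     = []
    recovers : ∀ c T → T ∈ block c → ∀ a → a ℕ.< m → choiceOf μ T a ≡ c a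
    recovers c T p with keepIf-∈⁻ (validChoice? m μ c) _ T p
    ... | (valid , q) with ∈-map⁻ (raise m μ) q
    ...   | (T′ , t , refl) with staircase-or-empty m (ν μ c)
    ...     | inj₁ stν  = choiceOf-raise m μ c st (proj₁ valid) T′
                            (fillings-sound m (ν μ c) (validChoice-decreasing m μ c valid) stν T′ t)
    ...     | inj₂ none = ⊥-elim (¬Any[] (subst (T′ ∈_) none t))

-- Every filling is in the list: remove the entries 1 and lower the rest.
module Completeness where
  open Multilinear using (Choice)
  open Choices
  open Enumeration
  open GridFacts
  open ListFacts
  open ValidFillings
  open ValidFilling
  open Uniqueness using (endsInOne; endsInOne-true; endsInOne-false; choiceOf; pred<)

  -- A filling forces μ ⊆ δ_{m-1}: row a strictly decreases from at most
  -- m-1-a down to at least 1, so it has at most m-1-a boxes.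
  filling⇒staircase : ∀ m μ F → ValidFilling m μ F → (∀ a → a ℕ.< m → μ a ≤ m) → Staircase m μ
  filling⇒staircase m μ F vF μ≤m a a<m with μ a in μa
  ... | zero  = a<m
  ... | suc k = subst (_≤ m) (ℕP.+-suc (suc k) a)
                  (subst (suc k ℕ.+ suc a ≤_) (ℕP.m∸n+n≡m a<m) (ℕP.+-monoˡ-≤ (suc a) lengthBound))
    where
    k<μa : k ℕ.< μ a
    k<μa = subst (k ℕ.<_) (sym μa) ℕP.≤-refl
    col<m : ∀ b → b ℕ.< μ a → b ℕ.< m
    col<m b p = ℕP.<-≤-trans p (μ≤m a a<m)
    decay : ∀ b → b ℕ.< μ a → F a b ℕ.+ b ≤ m ∸ suc a
    decay zero    p = subst (_≤ m ∸ suc a) (sym (ℕP.+-identityʳ (F a 0))) (flagged vF a 0 a<m (col<m 0 p) p)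
    decay (suc b) p = ℕP.≤-trans (ℕP.≤-reflexive (ℕP.+-suc (F a (suc b)) b))
                        (ℕP.≤-trans (ℕP.+-monoˡ-≤ b (rowStrict vF a b (suc b) a<m (col<m (suc b) p) ℕP.≤-refl p))
                                    (decay b (ℕP.<-trans ℕP.≤-refl p)))
    lengthBound : 1 ℕ.+ k ≤ m ∸ suc a
    lengthBound = ℕP.≤-trans (ℕP.+-monoˡ-≤ k (positive vF a k a<m (col<m k k<μa) k<μa)) (decay k k<μa)

  bool-cases : ∀ (b : Bool) → (b ≡ false) ⊎ (b ≡ true)
  bool-cases false = inj₁ refl
  bool-cases true  = inj₂ refl

  ≡pred : ∀ b x → x ∸ 1 ≤ b → b ℕ.< x → b ≡ x ∸ 1
  ≡pred b (suc x) p (s≤s q) = ℕP.≤-antisym q p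

  ∸1-mono-< : ∀ x y → 1 ≤ x → x ℕ.< y → x ∸ 1 ℕ.< y ∸ 1
  ∸1-mono-< (suc x) (suc y) _ (s≤s p) = p

  -- Peeling a filling T of μ on m+1 rows: c marks the rows ending in a 1,
  -- and T′ (entries lowered by one) is a filling of ν μ c on m rows.
  module Peel (m : ℕ) (μ : ℕ → ℕ) (dec : Decreasing (suc m) μ) (st : Staircase (suc m) μ)
              (T : Grid (suc m)) (vT : ValidFilling (suc m) μ (at T)) where
    F : ℕ → ℕ → ℕ
    F = at T
    c : Choice
    c = truncate m (choiceOf μ T)
    ν′ : ℕ → ℕ
    ν′ = ν μ c

    T′ : Grid m
    T′ = grid m (λ a b → at T a b ∸ 1)

    at-T′ : ∀ a b → a ℕ.< m → b ℕ.< m → at T′ a b ≡ F a b ∸ 1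
    at-T′ = at-grid m (λ a b → at T a b ∸ 1)

    μ≤m : ∀ a → a ℕ.< suc m → μ a ≤ m
    μ≤m a p = ℕP.≤-trans (ℕP.m≤m+n (μ a) a) (ℕP.≤-pred (st a p))
    ↑ : ∀ {a} → a ℕ.< m → a ℕ.< suc m
    ↑ = ℕP.m<n⇒m<1+n
    col<m : ∀ a b → a ℕ.< suc m → b ℕ.< μ a → b ℕ.< m
    col<m a b p q = ℕP.<-≤-trans q (μ≤m a p)

    lastRowEmpty : μ m ≡ 0
    lastRowEmpty = ℕP.n≤0⇒n≡0 (ℕP.+-cancelʳ-≤ m (μ m) 0 (ℕP.≤-pred (st m ℕP.≤-refl)))

    marked : ∀ a → a ℕ.< m → c a ≡ true → 1 ≤ μ a × F a (μ a ∸ 1) ≡ 1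
    marked a p e = endsInOne-true (μ a) (F a (μ a ∸ 1)) (trans (sym (truncate-< m _ a p)) e)
    unmarked : ∀ a → a ℕ.< m → c a ≡ false → 1 ≤ μ a → F a (μ a ∸ 1) ≢ 1
    unmarked a p e = endsInOne-false (μ a) (F a (μ a ∸ 1)) (trans (sym (truncate-< m _ a p)) e)

    removable : Removable m μ c
    removable a p with c a in e
    ... | false = inj₁ refl
    ... | true  = inj₂ (proj₁ (marked a p e))

    -- If row a ends in a 1 and row a+1 of equal length did not, the entry
    -- below that 1 would be ≤ 1 and ≥ 1, i.e. a 1 ending row a+1.
    staysDecreasing : StaysDecreasing m μ c
    staysDecreasing a a<m sa<m with c a in ca | c (suc a) in csa
    ... | false | b₂    = ℕP.≤-trans (ℕP.m∸n≤m (μ (suc a)) (bit b₂)) (dec a (↑ sa<m))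
    ... | true  | true  = ℕP.∸-monoˡ-≤ 1 (dec a (↑ sa<m))
    ... | true  | false with μ (suc a) ℕ.≤? μ a ∸ 1
    ...   | yes le  = le
    ...   | no  ¬le = ⊥-elim (unmarked (suc a) sa<m csa (subst (1 ≤_) (sym sameLength) 1≤μa) endsInOne′)
      where
      1≤μa : 1 ≤ μ a
      1≤μa = proj₁ (marked a a<m ca)
      sameLength : μ (suc a) ≡ μ a
      sameLength = ℕP.≤-antisym (dec a (↑ sa<m))
                     (subst (_≤ μ (suc a)) (trans (ℕP.+-comm 1 (μ a ∸ 1)) (ℕP.m∸n+n≡m 1≤μa)) (ℕP.≰⇒> ¬le))
      below : μ a ∸ 1 ℕ.< μ (suc a)
      below = subst (μ a ∸ 1 ℕ.<_) (sym sameLength) (pred< (μ a) 1≤μa)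
      inGrid : μ a ∸ 1 ℕ.< suc m
      inGrid = ↑ (col<m (suc a) (μ a ∸ 1) (↑ sa<m) below)
      endsInOne′ : F (suc a) (μ (suc a) ∸ 1) ≡ 1
      endsInOne′ = trans (cong (λ z → F (suc a) (z ∸ 1)) sameLength)
        (ℕP.≤-antisym (subst (F (suc a) (μ a ∸ 1) ≤_) (proj₂ (marked a a<m ca))
                             (colWeak vT a (suc a) (μ a ∸ 1) (↑ sa<m) inGrid ℕP.≤-refl below))
                      (positive vT (suc a) (μ a ∸ 1) (↑ sa<m) inGrid below))

    valid : ValidChoice m μ c
    valid = removable , staysDecreasing

    -- Inside ν′ all entries are at least 2: before the last box of row a
    -- because rows decrease strictly, at the last box because it is not a 1.
    atLeastTwo : ∀ a b → a ℕ.< m → b ℕ.< ν′ a → 2 ≤ F a b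
    atLeastTwo a b a<m bν with b ℕ.<? μ a ∸ 1
    ... | yes lt = ℕP.<-≤-trans (s≤s (positive vT a (μ a ∸ 1) (↑ a<m) lastInGrid (pred< (μ a) 1≤μa)))
                                (rowStrict vT a b (μ a ∸ 1) (↑ a<m) lastInGrid lt (pred< (μ a) 1≤μa))
      where
      1≤μa : 1 ≤ μ a
      1≤μa = ℕP.≤-trans (s≤s z≤n) (ℕP.<-≤-trans bν (ν≤μ μ c a))
      lastInGrid : μ a ∸ 1 ℕ.< suc m
      lastInGrid = ↑ (col<m a (μ a ∸ 1) (↑ a<m) (pred< (μ a) 1≤μa))
    ... | no ¬lt with bool-cases (c a)
    ...   | inj₂ ct = ⊥-elim (¬lt (subst (b ℕ.<_) (cong (λ z → μ a ∸ bit z) ct) bν))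
    ...   | inj₁ cf = subst (λ z → 2 ≤ F a z) (sym b≡last)
                        (ℕP.≤∧≢⇒< (positive vT a (μ a ∸ 1) (↑ a<m) (↑ (col<m a (μ a ∸ 1) (↑ a<m) (pred< (μ a) 1≤μa))) (pred< (μ a) 1≤μa))
                                  (λ e → unmarked a a<m cf 1≤μa (sym e)))
      where
      b<μ : b ℕ.< μ a
      b<μ = ℕP.<-≤-trans bν (ν≤μ μ c a)
      1≤μa : 1 ≤ μ a
      1≤μa = ℕP.≤-trans (s≤s z≤n) b<μ
      b≡last : b ≡ μ a ∸ 1
      b≡last = ≡pred b (μ a) (ℕP.≮⇒≥ ¬lt) b<μ

    -- The five conditions for T′.  Outside ν′ the entry of T is 0 or, on a
    -- removed box, 1; either way it is lowered to 0.
    zeroOutside′ : ∀ a b → a ℕ.< m → b ℕ.< m → ν′ a ≤ b → at T′ a b ≡ 0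
    zeroOutside′ a b a<m b<m le = trans (at-T′ a b a<m b<m) (ℕP.m≤n⇒m∸n≡0 atMostOne)
      where
      atMostOne : F a b ≤ 1
      atMostOne with μ a ℕ.≤? b
      ... | yes μle = subst (_≤ 1) (sym (zeroOutside vT a b (↑ a<m) (↑ b<m) μle)) z≤n
      ... | no ¬μle with bool-cases (c a)
      ...   | inj₁ cf = ⊥-elim (¬μle (subst (_≤ b) (cong (λ z → μ a ∸ bit z) cf) le))
      ...   | inj₂ ct = ℕP.≤-reflexive (trans (cong (F a) (≡pred b (μ a) (subst (_≤ b) (cong (λ z → μ a ∸ bit z) ct) le) (ℕP.≰⇒> ¬μle)))
                                              (proj₂ (marked a a<m ct)))

    positive′ : ∀ a b → a ℕ.< m → b ℕ.< m → b ℕ.< ν′ a → 1 ≤ at T′ a b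
    positive′ a b a<m b<m bν = subst (1 ≤_) (sym (at-T′ a b a<m b<m)) (ℕP.∸-monoˡ-≤ 1 (atLeastTwo a b a<m bν))

    flagged′ : ∀ a b → a ℕ.< m → b ℕ.< m → b ℕ.< ν′ a → at T′ a b ≤ m ∸ suc a
    flagged′ a b a<m b<m bν = subst₂ _≤_ (sym (at-T′ a b a<m b<m))
      (trans (ℕP.∸-+-assoc m a 1) (cong (m ∸_) (ℕP.+-comm a 1)))
      (ℕP.∸-monoˡ-≤ 1 (flagged vT a b (↑ a<m) (↑ b<m) (ℕP.<-≤-trans bν (ν≤μ μ c a))))

    rowStrict′ : ∀ a b b′ → a ℕ.< m → b′ ℕ.< m → b ℕ.< b′ → b′ ℕ.< ν′ a → at T′ a b′ ℕ.< at T′ a b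
    rowStrict′ a b b′ a<m b′<m bb′ b′ν = subst₂ ℕ._<_ (sym (at-T′ a b′ a<m b′<m)) (sym (at-T′ a b a<m (ℕP.<-trans bb′ b′<m)))
      (∸1-mono-< (F a b′) (F a b) (ℕP.≤-trans (s≤s z≤n) (atLeastTwo a b′ a<m b′ν))
                 (rowStrict vT a b b′ (↑ a<m) (↑ b′<m) bb′ (ℕP.<-≤-trans b′ν (ν≤μ μ c a))))

    colWeak′ : ∀ a a′ b → a′ ℕ.< m → b ℕ.< m → a ℕ.< a′ → b ℕ.< ν′ a′ → at T′ a′ b ≤ at T′ a b
    colWeak′ a a′ b a′<m b<m aa′ bν = subst₂ _≤_ (sym (at-T′ a′ b a′<m b<m)) (sym (at-T′ a b (ℕP.<-trans aa′ a′<m) b<m))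
      (ℕP.∸-monoˡ-≤ 1 (colWeak vT a a′ b (↑ a′<m) (↑ b<m) aa′ (ℕP.<-≤-trans bν (ν≤μ μ c a′))))

    lowered-valid : ValidFilling m ν′ (at T′)
    lowered-valid = record
      { zeroOutside = zeroOutside′ ; positive = positive′ ; flagged = flagged′ ; rowStrict = rowStrict′ ; colWeak = colWeak′ }

    lowered-staircase : Staircase m ν′
    lowered-staircase = filling⇒staircase m ν′ (at T′) lowered-valid (λ a p → ℕP.≤-trans (ν≤μ μ c a) (μ≤m a (↑ p)))

    T≡raise : T ≡ raise m μ T′
    T≡raise = grid-ext T (raise m μ T′) (λ a b p q → trans (byBox a b p q (b ℕ.<? μ a)) (sym (raise-at m μ T′ a b p q)))
      where
      byBox : ∀ a b → a ℕ.< suc m → b ℕ.< suc m → Dec (b ℕ.< μ a) → at T a b ≡ at T′ a b ℕ.+ inRow b (μ a)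
      byBox a b p q (yes lt) = trans (sym (ℕP.m∸n+n≡m (positive vT a b p q lt)))
                                     (cong₂ ℕ._+_ (sym (at-T′ a b a<m (col<m a b p lt))) (sym (inRow-< b (μ a) lt)))
        where
        a<m : a ℕ.< m
        a<m = ℕP.≤-trans (ℕP.+-monoˡ-≤ a (ℕP.≤-trans (s≤s z≤n) lt)) (ℕP.≤-pred (st a p))
      byBox a b p q (no ¬lt) = trans (zeroOutside vT a b p q (ℕP.≮⇒≥ ¬lt)) (sym (cong₂ ℕ._+_ T′zero (inRow-≥ b (μ a) (ℕP.≮⇒≥ ¬lt))))
        where
        T′zero : at T′ a b ≡ 0
        T′zero with a ℕ.<? m | b ℕ.<? m
        ... | yes a<m | yes b<m = trans (at-T′ a b a<m b<m) (cong (_∸ 1) (zeroOutside vT a b p q (ℕP.≮⇒≥ ¬lt)))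
        ... | no  a≮m | _       = at-outsideRows T′ a b (ℕP.≮⇒≥ a≮m)
        ... | yes _   | no  b≮m = at-outsideColumns T′ a b (ℕP.≮⇒≥ b≮m)

  fillings-complete : ∀ m μ → Decreasing m μ → Staircase m μ → ∀ T → ValidFilling m μ (at T) → T ∈ fillings m μ
  fillings-complete zero    μ dec st []  vT = here refl
  fillings-complete (suc m) μ dec st T vT =
    keepIf-∈⁺ (μ m ℕ.≟ 0) _ T lastRowEmpty
      (concatChoices-∈⁺ m (λ c′ → keepIf (validChoice? m μ c′) (map (raise m μ) (fillings m (ν μ c′)))) (choiceOf μ T) T
        (keepIf-∈⁺ (validChoice? m μ c) _ T valid
          (subst (_∈ map (raise m μ) (fillings m ν′)) (sym T≡raise)
            (∈-map⁺ (raise m μ) (fillings-complete m ν′ (validChoice-decreasing m μ c valid) lowered-staircase T′ lowered-valid)))))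
    where open Peel m μ dec st T vT

module Assembly where
  open Choices using (Decreasing)
  open Recurrences using (detA′; detB′)
  open Enumeration
  open GridFacts
  open ValidFillings
  open Counting using (boxes)

  extend : ∀ n → (Fin n → ℕ) → ℕ → ℕ
  extend zero    f a       = 0
  extend (suc n) f zero    = f fzero
  extend (suc n) f (suc a) = extend n (λ i → f (fsuc i)) a

  extend-toℕ : ∀ n f (i : Fin n) → f i ≡ extend n f (toℕ i)
  extend-toℕ (suc n) f fzero    = refl
  extend-toℕ (suc n) f (fsuc i) = extend-toℕ n (λ i → f (fsuc i)) i

  extend-fromℕ< : ∀ n f a (a<n : a ℕ.< n) → f (fromℕ< a<n) ≡ extend n f a
  extend-fromℕ< n f a a<n = trans (extend-toℕ n f (fromℕ< a<n)) (cong (extend n f) (toℕ-fromℕ< a<n))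

  size-boxes : ∀ n (f : Fin n → ℕ) → size n f ≡ boxes n (extend n f)
  size-boxes zero    f = refl
  size-boxes (suc n) f = cong (f fzero ℕ.+_) (size-boxes n (λ i → f (fsuc i)))

  inStaircase⇒decreasing : ∀ n μ → InStaircase n μ → Decreasing n (extend n μ)
  inStaircase⇒decreasing n μ ins a sa<n =
    subst₂ _≤_ (extend-fromℕ< n μ (suc a) sa<n) (extend-fromℕ< n μ a a<n)
      (InStaircase.decreasing ins (fromℕ< a<n) (fromℕ< sa<n)
         (subst₂ ℕ._<_ (sym (toℕ-fromℕ< a<n)) (sym (toℕ-fromℕ< sa<n)) ℕP.≤-refl))
    where a<n = ℕP.<-trans (ℕP.n<1+n a) sa<n

  inStaircase⇒staircase : ∀ n μ → InStaircase n μ → Staircase n (extend n μ)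
  inStaircase⇒staircase n μ ins a a<n =
    subst (_≤ n) (ℕP.+-suc (extend n μ a) a)
      (subst (extend n μ a ℕ.+ suc a ≤_) (ℕP.m∸n+n≡m a<n)
        (ℕP.+-monoˡ-≤ (suc a) (subst₂ _≤_ (extend-fromℕ< n μ a a<n) (cong (λ z → n ∸ suc z) (toℕ-fromℕ< a<n))
                                      (InStaircase.bounded ins (fromℕ< a<n)))))

  detA≡detA′ : ∀ n μ → detA n μ ≡ detA′ n (extend n μ)
  detA≡detA′ n μ = Determinant.det-ext n (λ i j → cong (binomℤ (n ∸ suc (toℕ i)))
    (trans (regroup (+ μ j) (+ toℕ i) (+ toℕ j)) (cong (λ z → + z + - + toℕ j + + toℕ i) (extend-toℕ n μ j))))
    where
    regroup : ∀ u i j → u + i - j ≡ u + - j + i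
    regroup = solve-∀

  detB≡detB′ : ∀ n μ → detB n μ ≡ detB′ n (extend n μ)
  detB≡detB′ n μ = Determinant.det-ext n (λ i j →
    cong (λ z → + ((2 ℕ.* n ∸ 2 ℕ.* suc (toℕ i)) C (z ℕ.+ n ∸ suc (toℕ j)))) (extend-toℕ n μ j))

  module Conversion (n : ℕ) (μ : Fin n → ℕ) where
    μ′ : ℕ → ℕ
    μ′ = extend n μ

    toValidFilling : ∀ T → IsReverseFlagged n μ T → ValidFilling n μ′ (at T)
    toValidFilling T v = record
      { zeroOutside = λ a b p q le → trans (at-fromℕ< T a b p q)
          (R.outside (fromℕ< p) (fromℕ< q) (subst₂ _≤_ (sym (extend-fromℕ< n μ a p)) (sym (toℕ-fromℕ< q)) le))
      ; positive = λ a b p q lt → subst (1 ≤_) (sym (at-fromℕ< T a b p q))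
          (R.positive (fromℕ< p) (fromℕ< q) (inRow′ a b p q lt))
      ; flagged = λ a b p q lt → subst₂ _≤_ (sym (at-fromℕ< T a b p q)) (cong (λ z → n ∸ suc z) (toℕ-fromℕ< p))
          (R.flagged (fromℕ< p) (fromℕ< q) (inRow′ a b p q lt))
      ; rowStrict = λ a b b′ p q′ bb′ lt → subst₂ ℕ._<_ (sym (at-fromℕ< T a b′ p q′)) (sym (at-fromℕ< T a b p (ℕP.<-trans bb′ q′)))
          (R.rowStrict (fromℕ< p) (fromℕ< (ℕP.<-trans bb′ q′)) (fromℕ< q′)
             (subst₂ ℕ._<_ (sym (toℕ-fromℕ< (ℕP.<-trans bb′ q′))) (sym (toℕ-fromℕ< q′)) bb′) (inRow′ a b′ p q′ lt))
      ; colWeak = λ a a′ b p′ q aa′ lt → subst₂ _≤_ (sym (at-fromℕ< T a′ b p′ q)) (sym (at-fromℕ< T a b (ℕP.<-trans aa′ p′) q))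
          (R.colWeak (fromℕ< (ℕP.<-trans aa′ p′)) (fromℕ< p′) (fromℕ< q)
             (subst₂ ℕ._<_ (sym (toℕ-fromℕ< (ℕP.<-trans aa′ p′))) (sym (toℕ-fromℕ< p′)) aa′) (inRow′ a′ b p′ q lt))
      }
      where
      module R = IsReverseFlagged v
      inRow′ : ∀ a b (p : a ℕ.< n) (q : b ℕ.< n) → b ℕ.< μ′ a → toℕ (fromℕ< q) ℕ.< μ (fromℕ< p)
      inRow′ a b p q lt = subst₂ ℕ._<_ (sym (toℕ-fromℕ< q)) (sym (extend-fromℕ< n μ a p)) lt

    fromValidFilling : ∀ T → ValidFilling n μ′ (at T) → IsReverseFlagged n μ T
    fromValidFilling T v = record
      { outside = λ i j le → trans (sym (at-entry T i j))
          (V.zeroOutside (toℕ i) (toℕ j) (toℕ<n i) (toℕ<n j) (subst (_≤ toℕ j) (extend-toℕ n μ i) le))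
      ; positive = λ i j lt → subst (1 ≤_) (at-entry T i j)
          (V.positive (toℕ i) (toℕ j) (toℕ<n i) (toℕ<n j) (inRow′ i j lt))
      ; flagged = λ i j lt → subst (_≤ n ∸ suc (toℕ i)) (at-entry T i j)
          (V.flagged (toℕ i) (toℕ j) (toℕ<n i) (toℕ<n j) (inRow′ i j lt))
      ; rowStrict = λ i j k jk lt → subst₂ ℕ._<_ (at-entry T i k) (at-entry T i j)
          (V.rowStrict (toℕ i) (toℕ j) (toℕ k) (toℕ<n i) (toℕ<n k) jk (inRow′ i k lt))
      ; colWeak = λ i i′ j ii′ lt → subst₂ _≤_ (at-entry T i′ j) (at-entry T i j)
          (V.colWeak (toℕ i) (toℕ i′) (toℕ j) (toℕ<n i′) (toℕ<n j) ii′ (inRow′ i′ j lt))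
      }
      where
      module V = ValidFilling v
      inRow′ : ∀ i j → toℕ j ℕ.< μ i → toℕ j ℕ.< μ′ (toℕ i)
      inRow′ i j = subst (toℕ j ℕ.<_) (extend-toℕ n μ i)

  unique-lookup : ∀ {X : Set} (xs : List X) → Unique xs → ∀ i j → List.lookup xs i ≡ List.lookup xs j → i ≡ j
  unique-lookup (x ∷ xs) (px ∷ u) fzero    fzero    e = refl
  unique-lookup (x ∷ xs) (px ∷ u) fzero    (fsuc j) e = ⊥-elim (All.lookup px (∈-lookup j) e)
  unique-lookup (x ∷ xs) (px ∷ u) (fsuc i) fzero    e = ⊥-elim (All.lookup px (∈-lookup i) (sym e))
  unique-lookup (x ∷ xs) (px ∷ u) (fsuc i) (fsuc j) e = cong fsuc (unique-lookup xs u i j e)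

  filling-≡ : ∀ {n μ} {T T′ : Grid n} .{v : IsReverseFlagged n μ T} .{v′ : IsReverseFlagged n μ T′} →
    T ≡ T′ → filling T v ≡ filling T′ v′
  filling-≡ refl = refl

  fillings↔ : ∀ n μ → InStaircase n μ → Filling n μ ↔ Fin (count n (extend n μ))
  fillings↔ n μ ins = mk↔ₛ′ to from to∘from from∘to
    where
    open Conversion n μ
    dec : Decreasing n μ′
    dec = inStaircase⇒decreasing n μ ins
    st : Staircase n μ′
    st = inStaircase⇒staircase n μ ins
    list : List (Grid n)
    list = fillings n μ′
    open import Data.List.Membership.DecPropositional (VecP.≡-dec (VecP.≡-dec ℕ._≟_)) using (_∈?_)
    -- membership is decidable, so it can be recovered from an irrelevant proof
    member : (f : Filling n μ) → Filling.matrix f ∈ list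
    member (filling T v) with T ∈? list
    ... | yes p  = p
    ... | no  ¬p = ⊥-elim-irr (¬p (Completeness.fillings-complete n μ′ dec st T (toValidFilling T v)))
    to : Filling n μ → Fin (length list)
    to f = index (member f)
    from : Fin (length list) → Filling n μ
    from i = filling (List.lookup list i)
                     (fromValidFilling _ (Soundness.fillings-sound n μ′ dec st (List.lookup list i) (∈-lookup i)))
    to∘from : ∀ i → to (from i) ≡ i
    to∘from i = unique-lookup list (Uniqueness.fillings-unique n μ′ dec st) _ _ (sym (lookup-index (member (from i))))
    from∘to : ∀ f → from (to f) ≡ f
    from∘to f = filling-≡ (sym (lookup-index (member f)))

open Assembly
open Enumeration using (count)
open Recurrences using (detB′)
open Counting using (weightB; detA′≡count; detB′≡weighted-count)

corollary4p3 : (n : ℕ) → 1 ≤ n → (μ : Fin n → ℕ) → InStaircase n μ →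
    Σ ℕ (λ r → (Filling n μ ↔ Fin r)
    × (+ r ≡ detA n μ)
    × (+ (2 ^ ((n C 2) ∸ size n μ)) * + r ≡ detB n μ))
corollary4p3 n _ μ ins = count n μ′ , fillings↔ n μ ins , countsA , countsB
  where
  open ≡-Reasoning
  μ′ : ℕ → ℕ
  μ′ = extend n μ
  dec : Choices.Decreasing n μ′
  dec = inStaircase⇒decreasing n μ ins
  countsA : + count n μ′ ≡ detA n μ
  countsA = sym (trans (detA≡detA′ n μ) (detA′≡count n μ′ dec))
  countsB : + (2 ^ ((n C 2) ∸ size n μ)) * + count n μ′ ≡ detB n μ
  countsB = begin
    + (2 ^ ((n C 2) ∸ size n μ)) * + count n μ′ ≡⟨ cong (λ s → + (2 ^ ((n C 2) ∸ s)) * + count n μ′) (size-boxes n μ) ⟩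
    weightB n μ′ * + count n μ′                 ≡⟨ sym (detB′≡weighted-count n μ′ dec) ⟩
    detB′ n μ′                                  ≡⟨ sym (detB≡detB′ n μ) ⟩
    detB n μ ∎
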